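{- For every $n\geq 1$, let $M(n)$ be the number of (distinct, not necessarily inequivalent) self-dual $L$-codes of length $n$. Then $$M(n)=\sum_{[C]}\frac{2^n\cdot n!}{|\mathrm{Aut}(C)|}=\prod_{i=1}^n(2^i+1),$$ where the sum runs over the equivalence classes $[C]$ of self-dual $L$-codes of length $n$.
   Context: Let $L=\{0,1,\omega,\bar\omega\}$ be the Klein four-group $\mathbf{Z}_2\times\mathbf{Z}_2$ (so $1+\omega=\bar\omega$, etc.). Define $|0|^2=0$, $|1|^2=1$, $|\omega|^2=|\bar\omega|^2=2$ and $q(x)=|x|^2 \bmod 2$. The dot product on $L$ is $x\cdot y=q(x+y)-q(x)-q(y)\in\mathbf{F}_2$; explicitly $x\cdot y=1$ iff $x,y$ are distinct and both nonzero. On $L^n$ the scalar product is $(\mathbf{x},\mathbf{y})=\sum_i x_i\cdot y_i\in\mathbf{F}_2$. An $L$-code of length $n$ is a subgroup $C\subseteq L^n$. Its dual is $C^\perp=\{\mathbf{x}\in L^n:(\mathbf{x},\mathbf{y})=0\ \forall \mathbf{y}\in C\}$; $C$ is self-dual if $C=C^\perp$. The group $G=S_2^n{:}S_n$ (order $2^n n!$) acts on $L^n$ by permuting the coordinates and independently interchanging $\omega$ and $\bar\omega$ in each coordinate; two codes are equivalent if they lie in the same $G$-orbit, and $\mathrm{Aut}(C)=\{g\in G: gC=C\}$. -}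

module Defs where

open import Data.Nat using (ℕ; zero; suc; _+_; _*_; _^_; _%_; _/_; _!)
open import Data.Bool using (Bool; true; false)
open import Data.Fin using (Fin)
open import Data.Vec using (Vec; []; _∷_; lookup; zipWith; tabulate)
import Data.Vec as Vec
open import Data.List using (List; []; _∷_; length; map)
open import Data.Nat.ListAction using (sum)
open import Data.List.Membership.Propositional using (_∈_)
open import Data.List.Relation.Unary.Unique.Propositional using (Unique)
open import Data.List.Relation.Unary.All using (All)
open import Data.List.Relation.Unary.Any using (Any)
open import Data.List.Relation.Unary.AllPairs using (AllPairs)
open import Data.Product using (Σ; _×_; _,_; ∃-syntax)
open import Function.Bundles using (_⇔_)
open import Relation.Binary.PropositionalEquality using (_≡_)
open import Relation.Nullary using (¬_)

data L : Set where
  𝟘 𝟙 ω ω̄ : L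

infixl 6 _⊕_
_⊕_ : L → L → L
𝟘 ⊕ y  = y
x ⊕ 𝟘  = x
𝟙 ⊕ 𝟙  = 𝟘
𝟙 ⊕ ω  = ω̄
𝟙 ⊕ ω̄  = ω
ω ⊕ 𝟙  = ω̄
ω ⊕ ω  = 𝟘
ω ⊕ ω̄  = 𝟙
ω̄ ⊕ 𝟙  = ω
ω̄ ⊕ ω  = 𝟙
ω̄ ⊕ ω̄  = 𝟘

norm : L → ℕ
norm 𝟘 = 0
norm 𝟙 = 1
norm ω = 2
norm ω̄ = 2

-- q(x) = |x|^2 mod 2, with F_2 represented by {0,1} ⊆ ℕ
q : L → ℕ
q x = norm x % 2

-- x · y = q(x+y) - q(x) - q(y) in F_2  (subtraction = addition mod 2)
dot : L → L → ℕ
dot x y = (q (x ⊕ y) + q x + q y) % 2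

Word : ℕ → Set
Word n = Vec L n

zeroW : ∀ {n} → Word n
zeroW = Vec.replicate _ 𝟘

_⊕ᵥ_ : ∀ {n} → Word n → Word n → Word n
_⊕ᵥ_ = zipWith _⊕_

scalar : ∀ {n} → Word n → Word n → ℕ
scalar x y = Vec.sum (zipWith dot x y) % 2

-- Subsets of L^n, represented concretely as a 4-ary trie of booleans
-- (a characteristic function L^n → Bool with decidable/propositional
-- equality: two subsets are equal iff they have the same elements).

Subset : ℕ → Set
Subset zero    = Bool
Subset (suc n) = Subset n × Subset n × Subset n × Subset n

member : ∀ {n} → Subset n → Word n → Bool
member {zero}  b [] = b
member {suc n} (a , b , c , d) (𝟘 ∷ xs) = member a xs
member {suc n} (a , b , c , d) (𝟙 ∷ xs) = member b xs
member {suc n} (a , b , c , d) (ω ∷ xs) = member c xs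
member {suc n} (a , b , c , d) (ω̄ ∷ xs) = member d xs

_∈S_ : ∀ {n} → Word n → Subset n → Set
x ∈S C = member C x ≡ true

-- An L-code: a subgroup of L^n (every element is its own inverse,
-- so closure under inverses is automatic).
IsCode : ∀ {n} → Subset n → Set
IsCode {n} C = (zeroW ∈S C) × (∀ (x y : Word n) → x ∈S C → y ∈S C → (x ⊕ᵥ y) ∈S C)

_∈Dual_ : ∀ {n} → Word n → Subset n → Set
_∈Dual_ {n} x C = ∀ (y : Word n) → y ∈S C → scalar x y ≡ 0

SelfDual : ∀ {n} → Subset n → Set
SelfDual {n} C = IsCode C × (∀ (x : Word n) → (x ∈S C) ⇔ (x ∈Dual C))

-- The group G = S_2^n : S_n, elements represented as raw pairs
-- (s , π) with s : Vec Bool n (which coordinates get ω ↔ ω̄ swapped)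
-- and π : Vec (Fin n) n, which must be a permutation (IsPerm).

swapω : Bool → L → L
swapω false x = x
swapω true  ω = ω̄
swapω true  ω̄ = ω
swapω true  x = x

Elt : ℕ → Set
Elt n = Vec Bool n × Vec (Fin n) n

IsPerm : ∀ {n} → Vec (Fin n) n → Set
IsPerm {n} π = ∀ (i j : Fin n) → lookup π i ≡ lookup π j → i ≡ j

InG : ∀ {n} → Elt n → Set
InG (s , π) = IsPerm π

act : ∀ {n} → Elt n → Word n → Word n
act (s , π) x = tabulate (λ i → swapω (lookup s i) (lookup x (lookup π i)))

MapsTo : ∀ {n} → Elt n → Subset n → Subset n → Set
MapsTo {n} g C D = ∀ (y : Word n) → (Σ (Word n) λ x → (x ∈S C) × (act g x ≡ y)) ⇔ (y ∈S D)

Equivalent : ∀ {n} → Subset n → Subset n → Set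
Equivalent {n} C D = Σ (Elt n) λ g → InG g × MapsTo g C D

InAut : ∀ {n} → Subset n → Elt n → Set
InAut C g = InG g × MapsTo g C C

-- Cardinality of a predicate on a type: P has exactly k elements iff
-- there is a duplicate-free list of length k whose members are exactly
-- the elements satisfying P.

HasCard : ∀ {A : Set} → (A → Set) → ℕ → Set
HasCard {A} P k = Σ (List A) λ l → Unique l × (∀ (x : A) → (x ∈ l) ⇔ P x) × (length l ≡ k)

prodFormula : ℕ → ℕ
prodFormula zero    = 1
prodFormula (suc n) = prodFormula n * (2 ^ suc n + 1)

-- natural-number division, total (value 0 for divisor 0; never used
-- with divisor 0 since |Aut(C)| ≥ 1)
_div_ : ℕ → ℕ → ℕ
m div zero    = 0
m div (suc k) = m / suc k

orbitTerm : (n a : ℕ) → ℕ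
orbitTerm n a = (2 ^ n * n !) div a

-- A system of representatives of the equivalence classes of self-dual
-- codes of length n, each paired with the order of its automorphism group.
IsClassSystem : (n : ℕ) → List (Subset n × ℕ) → Set
IsClassSystem n reps =
  All (λ { (C , a) → SelfDual C × HasCard (InAut C) a }) reps
  × AllPairs (λ { (C , _) (D , _) → ¬ Equivalent C D }) reps
  × (∀ (D : Subset n) → SelfDual D → Any (λ { (C , _) → Equivalent C D }) reps)

classSum : (n : ℕ) → List (Subset n × ℕ) → ℕ
classSum n reps = sum (map (λ { (C , a) → orbitTerm n a }) reps)

module Submission where

-- A
-- self-dual code W of length n+1 is "split" if it contains a word
-- (a,0,…,0) with a ≠ 0, and "glued" otherwise.  A split code is {0,a} × S
-- with S self-dual of length n, so there are 3·|SD n| of them.  A glued code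
-- W is recovered by gluing its residue C = {x | (0,x) or (1,x) ∈ W}, which is
-- self-dual of length n, along any word (ω or ω̄, y) ∈ W, where y ∉ C; W
-- contains exactly 2^n such words.  Counting the pairs (W, word) in two ways
-- gives 2^n·#glued = |SD n|·(4^n − 2^n)·2, hence |SD (n+1)| =
-- |SD n|·(2^(n+1) + 1).  This uses |C| = 2^n for self-dual C, proved by the
-- same case split.
--
-- Part 2 is orbit–stabiliser for G = S₂ⁿ:Sₙ (|G| = 2ⁿ·n!): G preserves
-- self-duality, each class [C] has |G|/|Aut C| members, and the classes of a
-- system of representatives partition the self-dual codes; so the class sum
-- counts the self-dual codes as well.

open import Defs
open import Data.Nat using (ℕ; zero; suc; _+_; _*_; _^_; _∸_; _/_; _%_; _!; _≤_; pred; >-nonZero)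
open import Data.Nat.Properties using (+-identityʳ; *-identityʳ; *-identityˡ; *-assoc; *-cancelʳ-≡; m+n∸m≡n; n∸n≡0; suc-pred; m^n>0)
open import Data.Nat.DivMod using (%-distribˡ-+; m*n/n≡m)
open import Data.Nat.Tactic.RingSolver using (solve-∀)
import Data.Nat as ℕ
open import Data.Bool using (Bool; true; false; _xor_; not; _∧_; _∨_)
open import Data.Bool.Properties using (xor-∧-commutativeRing; xor-assoc; xor-same; ∧-zeroʳ; ∨-zeroʳ)
import Data.Bool.Properties as Bool
open import Data.Fin using (Fin)
import Data.Fin as Fin
import Data.Fin.Properties as Fin
open import Data.Fin.Permutation using (permutation)
open import Data.Vec using (Vec; []; _∷_; lookup; tabulate; zipWith; replicate)
import Data.Vec as Vec
open import Data.Vec.Properties using (lookup∘tabulate; tabulate∘lookup; tabulate-cong; lookup-replicate; lookup-zipWith; zipWith-assoc; zipWith-comm; zipWith-identityˡ)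
open import Data.List using (List; []; _∷_; length; map; _++_; filter; allFin)
open import Data.List.Properties using (length-map; length-++; length-tabulate)
open import Data.Nat.ListAction using (sum)
open import Data.List.Membership.Propositional using (_∈_; lose; find)
open import Data.List.Membership.Propositional.Properties using (∈-map⁺; ∈-map⁻; ∈-++⁺ˡ; ∈-++⁺ʳ; ∈-++⁻; ∈-filter⁺; ∈-filter⁻; ∈-allFin)
open import Data.List.Membership.Propositional.Properties.WithK using (unique∧set⇒bag)
open import Data.List.Relation.Binary.BagAndSetEquality using (∼bag⇒↭)
open import Data.List.Relation.Binary.Permutation.Propositional.Properties using (↭-length)
open import Data.List.Relation.Unary.Any using (here; there; any?; satisfied)
open import Data.List.Relation.Unary.All using (All; []; _∷_; all?) renaming (lookup to All-lookup; tabulate to All-tabulate)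
open import Data.List.Relation.Unary.AllPairs using (AllPairs; []; _∷_)
import Data.List.Relation.Unary.AllPairs as AllPairs
open import Data.List.Relation.Unary.Unique.Propositional using (Unique)
import Data.List.Relation.Unary.Unique.Propositional.Properties as Unique
open import Data.Product using (Σ; _×_; _,_; proj₁; proj₂; ∃)
open import Data.Sum using (_⊎_; inj₁; inj₂; [_,_]′)
open import Data.Empty using (⊥; ⊥-elim)
open import Data.Unit using (⊤; tt)
open import Function using (_∘_)
open import Function.Bundles using (_⇔_; mk⇔; Equivalence)
import Function.Properties.Equivalence as ⇔
open import Algebra.Bundles using (CommutativeRing)
import Algebra.Properties.CommutativeMonoid.Sum as MonoidSum
open import Relation.Binary.PropositionalEquality
open import Relation.Binary.Definitions using (DecidableEquality)
open import Relation.Nullary using (¬_; Dec; yes; no)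
open import Relation.Nullary.Decidable using (_×-dec_; _→-dec_; _⊎-dec_; ¬?; map′; from-yes; ⌊_⌋)
open import Relation.Unary using (Decidable)

open Equivalence using (to; from)

private variable
  A B : Set
  n : ℕ

card-⇔ : {P Q : A → Set} {k : ℕ} → (∀ x → P x ⇔ Q x) → HasCard P k → HasCard Q k
card-⇔ e (l , u , m , len) = l , u , (λ x → ⇔.trans (m x) (e x)) , len

card-unique : {P : A → Set} {k m : ℕ} → HasCard P k → HasCard P m → k ≡ m
card-unique (l₁ , u₁ , m₁ , refl) (l₂ , u₂ , m₂ , refl) =
  ↭-length (∼bag⇒↭ (unique∧set⇒bag u₁ u₂ (λ {x} → ⇔.trans (m₁ x) (⇔.sym (m₂ x)))))

map-unique : (f : A → B) (l : List A) → (∀ {x y} → x ∈ l → y ∈ l → f x ≡ f y → x ≡ y) →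
  Unique l → Unique (map f l)
map-unique f [] inj [] = []
map-unique f (x ∷ l) inj (x∉l ∷ u) =
  fresh l x∉l (λ y∈l → inj (here refl) (there y∈l)) ∷ map-unique f l (λ p q → inj (there p) (there q)) u
  where
  fresh : ∀ l′ → All (λ y → ¬ x ≡ y) l′ → (∀ {y} → y ∈ l′ → f x ≡ f y → x ≡ y) →
    All (λ z → ¬ f x ≡ z) (map f l′)
  fresh [] [] _ = []
  fresh (y ∷ l′) (x≢y ∷ a) h = (λ e → x≢y (h (here refl) e)) ∷ fresh l′ a (λ p → h (there p))

card-image : {P : A → Set} {Q : B → Set} {k : ℕ} (f : A → B) →
  (∀ {x x′} → P x → P x′ → f x ≡ f x′ → x ≡ x′) →
  (∀ x → P x → Q (f x)) → (∀ y → Q y → Σ A (λ x → P x × f x ≡ y)) →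
  HasCard P k → HasCard Q k
card-image {P = P} {Q} f inj pq onto (l , u , m , len) =
  map f l , map-unique f l (λ p q → inj (to (m _) p) (to (m _) q)) u , mem , trans (length-map f l) len
  where
  mem : ∀ y → (y ∈ map f l) ⇔ Q y
  mem y = mk⇔ (λ y∈ → image (∈-map⁻ f y∈)) (λ qy → preimage (onto y qy))
    where
    image : ∃ (λ x → x ∈ l × y ≡ f x) → Q y
    image (x , x∈l , refl) = pq x (to (m x) x∈l)
    preimage : ∃ (λ x → P x × f x ≡ y) → y ∈ map f l
    preimage (x , px , refl) = ∈-map⁺ f (from (m x) px)

card-inverse : {P : A → Set} {Q : B → Set} {k : ℕ} (f : A → B) (g : B → A) →
  (∀ x → P x → Q (f x)) → (∀ y → Q y → P (g y)) →
  (∀ x → P x → g (f x) ≡ x) → (∀ y → Q y → f (g y) ≡ y) →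
  HasCard P k → HasCard Q k
card-inverse f g pq qp gf fg =
  card-image f (λ {x} {x′} px px′ e → trans (sym (gf x px)) (trans (cong g e) (gf x′ px′))) pq
    (λ y qy → g y , qp y qy , fg y qy)

card-⊎ : {P Q : A → Set} {k m : ℕ} → HasCard P k → HasCard Q m → (∀ x → P x → Q x → ⊥) →
  HasCard (λ x → P x ⊎ Q x) (k + m)
card-⊎ {P = P} {Q} (l₁ , u₁ , m₁ , refl) (l₂ , u₂ , m₂ , refl) disjoint =
  l₁ ++ l₂ , Unique.++⁺ u₁ u₂ (λ {x} (p , q) → disjoint x (to (m₁ x) p) (to (m₂ x) q)) ,
  (λ x → mk⇔ (split x ∘ ∈-++⁻ l₁) (join x)) , length-++ l₁
  where
  split : ∀ x → x ∈ l₁ ⊎ x ∈ l₂ → P x ⊎ Q x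
  split x (inj₁ i) = inj₁ (to (m₁ x) i)
  split x (inj₂ j) = inj₂ (to (m₂ x) j)
  join : ∀ x → P x ⊎ Q x → x ∈ l₁ ++ l₂
  join x (inj₁ p) = ∈-++⁺ˡ (from (m₁ x) p)
  join x (inj₂ q) = ∈-++⁺ʳ l₁ (from (m₂ x) q)

card-Σ-list : {Q : A → B → Set} (m : A → ℕ) (l : List A) → Unique l →
  (∀ x → x ∈ l → HasCard (Q x) (m x)) →
  HasCard (λ (p : A × B) → proj₁ p ∈ l × Q (proj₁ p) (proj₂ p)) (sum (map m l))
card-Σ-list m [] [] fibres = [] , [] , (λ p → mk⇔ (λ ()) (λ { (() , _) })) , refl
card-Σ-list {A = A} {B} {Q} m (x ∷ l) (x∉l ∷ u) fibres
  with fibres x (here refl) | card-Σ-list {Q = Q} m l u (λ y y∈l → fibres y (there y∈l))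
... | (lx , ux , mx , lenx) | (lr , ur , mr , lenr) =
  map (x ,_) lx ++ lr ,
  Unique.++⁺ (Unique.map⁺ (λ { refl → refl }) ux) ur (λ {p} (i , j) → disjoint p i j) ,
  (λ p → mk⇔ (forth p) (back p)) ,
  trans (length-++ (map (x ,_) lx)) (cong₂ _+_ (trans (length-map (x ,_) lx) lenx) lenr)
  where
  x∉ : x ∈ l → ⊥
  x∉ x∈ = All-lookup x∉l x∈ refl
  disjoint : (p : A × B) → p ∈ map (x ,_) lx → p ∈ lr → ⊥
  disjoint p i j with ∈-map⁻ (x ,_) i
  ... | (y , _ , refl) = x∉ (proj₁ (to (mr (x , y)) j))
  forth : ∀ p → p ∈ map (x ,_) lx ++ lr → proj₁ p ∈ (x ∷ l) × Q (proj₁ p) (proj₂ p)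
  forth p i with ∈-++⁻ (map (x ,_) lx) i
  ... | inj₂ j = there (proj₁ (to (mr p) j)) , proj₂ (to (mr p) j)
  ... | inj₁ j with ∈-map⁻ (x ,_) j
  ...   | (y , y∈ , refl) = here refl , to (mx y) y∈
  back : ∀ p → proj₁ p ∈ (x ∷ l) × Q (proj₁ p) (proj₂ p) → p ∈ map (x ,_) lx ++ lr
  back (_ , y) (here refl , qy) = ∈-++⁺ˡ (∈-map⁺ (x ,_) (from (mx y) qy))
  back p (there p∈ , qp) = ∈-++⁺ʳ (map (x ,_) lx) (from (mr p) (p∈ , qp))

card-Σ : {P : A → Set} {Q : A → B → Set} (m : A → ℕ) (l : List A) → Unique l →
  (∀ x → x ∈ l ⇔ P x) → (∀ x → P x → HasCard (Q x) (m x)) →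
  HasCard (λ (p : A × B) → P (proj₁ p) × Q (proj₁ p) (proj₂ p)) (sum (map m l))
card-Σ {Q = Q} m l u e fibres =
  card-⇔ (λ p → mk⇔ (λ { (i , q) → to (e _) i , q }) (λ { (pp , q) → from (e _) pp , q }))
    (card-Σ-list {Q = Q} m l u (λ x x∈l → fibres x (to (e x) x∈l)))

sum-const : (c : ℕ) (l : List A) → sum (map (λ _ → c) l) ≡ length l * c
sum-const c [] = refl
sum-const c (x ∷ l) = cong (c +_) (sum-const c l)

card-Σ-const : {P : A → Set} {Q : A → B → Set} {k c : ℕ} → HasCard P k →
  (∀ x → P x → HasCard (Q x) c) →
  HasCard (λ (p : A × B) → P (proj₁ p) × Q (proj₁ p) (proj₂ p)) (k * c)
card-Σ-const {Q = Q} {c = c} (l , u , e , refl) fibres =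
  subst (HasCard _) (sum-const c l) (card-Σ {Q = Q} (λ _ → c) l u e fibres)

card-nonempty : {P : A → Set} {k : ℕ} {x : A} → HasCard P k → P x → Σ ℕ (λ k′ → k ≡ suc k′)
card-nonempty {x = x} (l , _ , mem , len) px = nonempty l len (from (mem x) px)
  where
  nonempty : ∀ {k} (l : List _) → length l ≡ k → x ∈ l → Σ ℕ (λ k′ → k ≡ suc k′)
  nonempty (_ ∷ l′) len _ = length l′ , sym len

Full : (A : Set) → ℕ → Set
Full A n = HasCard {A} (λ _ → ⊤) n

card-filter : {P : A → Set} {n : ℕ} → Full A n → Decidable P → Σ ℕ (HasCard P)
card-filter (l , u , e , _) P? =
  length (filter P? l) , filter P? l , Unique.filter⁺ P? {xs = l} u ,
  (λ x → mk⇔ (λ i → proj₂ (∈-filter⁻ P? {xs = l} i)) (∈-filter⁺ P? (from (e x) tt))) , refl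

card-compl : {P : A → Set} {n k : ℕ} → Full A n → Decidable P → HasCard P k →
  HasCard (λ x → ¬ P x) (n ∸ k)
card-compl {P = P} {n} {k} full P? cardP
  with card-filter {P = λ x → ¬ P x} full (λ x → ¬? (P? x))
... | (m , cardP̸) = subst (HasCard _) m≡n∸k cardP̸
  where
  excluded-middle : ∀ x → (P x ⊎ ¬ P x) ⇔ ⊤
  excluded-middle x with P? x
  ... | yes p = mk⇔ _ (λ _ → inj₁ p)
  ... | no ¬p = mk⇔ _ (λ _ → inj₂ ¬p)
  m≡n∸k : m ≡ n ∸ k
  m≡n∸k = trans (sym (m+n∸m≡n k m))
    (cong (_∸ k) (card-unique (card-⇔ excluded-middle (card-⊎ cardP cardP̸ (λ x p ¬p → ¬p p))) full))

card-preimage : {P : A → Set} {Q : B → Set} {N k : ℕ} → Full A N → Decidable P → (f : A → B) →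
  (∀ {x x′} → P x → P x′ → f x ≡ f x′ → x ≡ x′) →
  (∀ x → P x → Q (f x)) → (∀ y → Q y → Σ A (λ x → P x × f x ≡ y)) →
  HasCard Q k → HasCard P k
card-preimage full P? f inj pq onto cardQ with card-filter full P?
... | (m , cardP) = subst (HasCard _) (card-unique (card-image f inj pq onto cardP) cardQ) cardP

∀? : {P : A → Set} {n : ℕ} → Full A n → Decidable P → Dec (∀ x → P x)
∀? (l , _ , e , _) P? = map′ (λ all x → All-lookup all (from (e x) tt)) (λ f → All-tabulate (λ {x} _ → f x)) (all? P? l)

∃? : {P : A → Set} {n : ℕ} → Full A n → Decidable P → Dec (Σ A P)
∃? (l , _ , e , _) P? = map′ satisfied (λ (x , p) → lose (from (e x) tt) p) (any? P? l)

_⇔?_ : {X Y : Set} → Dec X → Dec Y → Dec (X ⇔ Y)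
X? ⇔? Y? = map′ (λ (f , g) → mk⇔ f g) (λ e → to e , from e) ((X? →-dec Y?) ×-dec (Y? →-dec X?))

infix 4 _≟L_
_≟L_ : DecidableEquality L
𝟘 ≟L 𝟘 = yes refl
𝟘 ≟L 𝟙 = no λ ()
𝟘 ≟L ω = no λ ()
𝟘 ≟L ω̄ = no λ ()
𝟙 ≟L 𝟘 = no λ ()
𝟙 ≟L 𝟙 = yes refl
𝟙 ≟L ω = no λ ()
𝟙 ≟L ω̄ = no λ ()
ω ≟L 𝟘 = no λ ()
ω ≟L 𝟙 = no λ ()
ω ≟L ω = yes refl
ω ≟L ω̄ = no λ ()
ω̄ ≟L 𝟘 = no λ ()
ω̄ ≟L 𝟙 = no λ ()
ω̄ ≟L ω = no λ ()
ω̄ ≟L ω̄ = yes refl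

fullL : Full L 4
fullL = 𝟘 ∷ 𝟙 ∷ ω ∷ ω̄ ∷ [] ,
  ((λ ()) ∷ (λ ()) ∷ (λ ()) ∷ []) ∷ ((λ ()) ∷ (λ ()) ∷ []) ∷ ((λ ()) ∷ []) ∷ [] ∷ [] ,
  (λ x → mk⇔ _ (λ _ → listed x)) , refl
  where
  listed : ∀ x → x ∈ 𝟘 ∷ 𝟙 ∷ ω ∷ ω̄ ∷ []
  listed 𝟘 = here refl
  listed 𝟙 = there (here refl)
  listed ω = there (there (here refl))
  listed ω̄ = there (there (there (here refl)))

fullBool : Full Bool 2
fullBool = true ∷ false ∷ [] , ((λ ()) ∷ []) ∷ [] ∷ [] , (λ x → mk⇔ _ (λ _ → listed x)) , refl
  where
  listed : ∀ x → x ∈ true ∷ false ∷ []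
  listed true = here refl
  listed false = there (here refl)

-- Identities about finitely many elements of L and Bool are proved below by
-- evaluating a decision procedure: 'from-yes (∀L? λ a → …)'.
∀L? : {P : L → Set} → Decidable P → Dec (∀ x → P x)
∀L? = ∀? fullL

∀B? : {P : Bool → Set} → Decidable P → Dec (∀ x → P x)
∀B? = ∀? fullBool

infix 4 _≟B_
_≟B_ : DecidableEquality Bool
_≟B_ = Bool._≟_

xor≡false⇒≡ : ∀ p r → p xor r ≡ false → p ≡ r
xor≡false⇒≡ = from-yes (∀B? λ p → ∀B? λ r → (p xor r ≟B false) →-dec (p ≟B r))

bit : Bool → ℕ
bit true = 1
bit false = 0

⊕-comm : ∀ a b → a ⊕ b ≡ b ⊕ a
⊕-comm = from-yes (∀L? λ a → ∀L? λ b → a ⊕ b ≟L b ⊕ a)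

⊕-assoc : ∀ a b c → (a ⊕ b) ⊕ c ≡ a ⊕ (b ⊕ c)
⊕-assoc = from-yes (∀L? λ a → ∀L? λ b → ∀L? λ c → (a ⊕ b) ⊕ c ≟L a ⊕ (b ⊕ c))

⊕-identityʳ : ∀ a → a ⊕ 𝟘 ≡ a
⊕-identityʳ = from-yes (∀L? λ a → a ⊕ 𝟘 ≟L a)

⊕-self : ∀ a → a ⊕ a ≡ 𝟘
⊕-self = from-yes (∀L? λ a → a ⊕ a ≟L 𝟘)

⊕-cancel : ∀ a c → (a ⊕ c) ⊕ c ≡ a
⊕-cancel = from-yes (∀L? λ a → ∀L? λ c → (a ⊕ c) ⊕ c ≟L a)

⊕≡𝟘⇒≡ : ∀ a b → a ⊕ b ≡ 𝟘 → a ≡ b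
⊕≡𝟘⇒≡ = from-yes (∀L? λ a → ∀L? λ b → (a ⊕ b ≟L 𝟘) →-dec (a ≟L b))

dotᵇ : L → L → Bool
dotᵇ 𝟘 _ = false
dotᵇ _ 𝟘 = false
dotᵇ a b = not ⌊ a ≟L b ⌋

dot≡dotᵇ : ∀ a b → dot a b ≡ bit (dotᵇ a b)
dot≡dotᵇ = from-yes (∀L? λ a → ∀L? λ b → dot a b ℕ.≟ bit (dotᵇ a b))

dotᵇ-sym : ∀ a b → dotᵇ a b ≡ dotᵇ b a
dotᵇ-sym = from-yes (∀L? λ a → ∀L? λ b → dotᵇ a b ≟B dotᵇ b a)

dotᵇ-linear : ∀ a b c → dotᵇ (a ⊕ b) c ≡ dotᵇ a c xor dotᵇ b c
dotᵇ-linear = from-yes (∀L? λ a → ∀L? λ b → ∀L? λ c → dotᵇ (a ⊕ b) c ≟B dotᵇ a c xor dotᵇ b c)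

dotᵇ-self : ∀ a → dotᵇ a a ≡ false
dotᵇ-self = from-yes (∀L? λ a → dotᵇ a a ≟B false)

dotᵇ-zeroʳ : ∀ a → dotᵇ a 𝟘 ≡ false
dotᵇ-zeroʳ = from-yes (∀L? λ a → dotᵇ a 𝟘 ≟B false)

⊕ᵥ-comm : (x y : Word n) → x ⊕ᵥ y ≡ y ⊕ᵥ x
⊕ᵥ-comm = zipWith-comm ⊕-comm

⊕ᵥ-assoc : (x y z : Word n) → (x ⊕ᵥ y) ⊕ᵥ z ≡ x ⊕ᵥ (y ⊕ᵥ z)
⊕ᵥ-assoc = zipWith-assoc ⊕-assoc

⊕ᵥ-identityˡ : (x : Word n) → zeroW ⊕ᵥ x ≡ x
⊕ᵥ-identityˡ = zipWith-identityˡ (λ _ → refl)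

⊕ᵥ-identityʳ : (x : Word n) → x ⊕ᵥ zeroW ≡ x
⊕ᵥ-identityʳ x = trans (⊕ᵥ-comm x zeroW) (⊕ᵥ-identityˡ x)

⊕ᵥ-self : (x : Word n) → x ⊕ᵥ x ≡ zeroW
⊕ᵥ-self [] = refl
⊕ᵥ-self (a ∷ x) = cong₂ _∷_ (⊕-self a) (⊕ᵥ-self x)

⊕ᵥ-cancel : (x y : Word n) → (x ⊕ᵥ y) ⊕ᵥ y ≡ x
⊕ᵥ-cancel x y = trans (⊕ᵥ-assoc x y y) (trans (cong (x ⊕ᵥ_) (⊕ᵥ-self y)) (⊕ᵥ-identityʳ x))

⊕ᵥ-interchange : (a b c d : Word n) → (a ⊕ᵥ b) ⊕ᵥ (c ⊕ᵥ d) ≡ (a ⊕ᵥ c) ⊕ᵥ (b ⊕ᵥ d)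
⊕ᵥ-interchange a b c d = begin
  (a ⊕ᵥ b) ⊕ᵥ (c ⊕ᵥ d) ≡⟨ ⊕ᵥ-assoc a b (c ⊕ᵥ d) ⟩
  a ⊕ᵥ (b ⊕ᵥ (c ⊕ᵥ d)) ≡⟨ cong (a ⊕ᵥ_) (sym (⊕ᵥ-assoc b c d)) ⟩
  a ⊕ᵥ ((b ⊕ᵥ c) ⊕ᵥ d) ≡⟨ cong (λ v → a ⊕ᵥ (v ⊕ᵥ d)) (⊕ᵥ-comm b c) ⟩
  a ⊕ᵥ ((c ⊕ᵥ b) ⊕ᵥ d) ≡⟨ cong (a ⊕ᵥ_) (⊕ᵥ-assoc c b d) ⟩
  a ⊕ᵥ (c ⊕ᵥ (b ⊕ᵥ d)) ≡⟨ sym (⊕ᵥ-assoc a c (b ⊕ᵥ d)) ⟩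
  (a ⊕ᵥ c) ⊕ᵥ (b ⊕ᵥ d) ∎
  where open ≡-Reasoning

scalarᵇ : Word n → Word n → Bool
scalarᵇ [] [] = false
scalarᵇ (a ∷ x) (b ∷ y) = dotᵇ a b xor scalarᵇ x y

scalar≡scalarᵇ : (x y : Word n) → scalar x y ≡ bit (scalarᵇ x y)
scalar≡scalarᵇ [] [] = refl
scalar≡scalarᵇ (a ∷ x) (b ∷ y) = begin
  (dot a b + Vec.sum (zipWith dot x y)) % 2
    ≡⟨ %-distribˡ-+ (dot a b) (Vec.sum (zipWith dot x y)) 2 ⟩
  (dot a b % 2 + scalar x y) % 2
    ≡⟨ cong₂ (λ u v → (u % 2 + v) % 2) (dot≡dotᵇ a b) (scalar≡scalarᵇ x y) ⟩
  (bit (dotᵇ a b) % 2 + bit (scalarᵇ x y)) % 2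
    ≡⟨ bit-xor (dotᵇ a b) (scalarᵇ x y) ⟩
  bit (dotᵇ a b xor scalarᵇ x y) ∎
  where
  open ≡-Reasoning
  bit-xor : ∀ p r → (bit p % 2 + bit r) % 2 ≡ bit (p xor r)
  bit-xor = from-yes (∀B? λ p → ∀B? λ r → (bit p % 2 + bit r) % 2 ℕ.≟ bit (p xor r))

scalar≡0⇔ : (x y : Word n) → scalar x y ≡ 0 ⇔ scalarᵇ x y ≡ false
scalar≡0⇔ x y rewrite scalar≡scalarᵇ x y with scalarᵇ x y
... | true = mk⇔ (λ ()) (λ ())
... | false = mk⇔ (λ _ → refl) (λ _ → refl)

scalarᵇ-sym : (x y : Word n) → scalarᵇ x y ≡ scalarᵇ y x
scalarᵇ-sym [] [] = refl
scalarᵇ-sym (a ∷ x) (b ∷ y) = cong₂ _xor_ (dotᵇ-sym a b) (scalarᵇ-sym x y)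

scalarᵇ-linearˡ : (x y z : Word n) → scalarᵇ (x ⊕ᵥ y) z ≡ scalarᵇ x z xor scalarᵇ y z
scalarᵇ-linearˡ [] [] [] = refl
scalarᵇ-linearˡ (a ∷ x) (b ∷ y) (c ∷ z) =
  trans (cong₂ _xor_ (dotᵇ-linear a b c) (scalarᵇ-linearˡ x y z))
        (xor-interchange (dotᵇ a c) (dotᵇ b c) (scalarᵇ x z) (scalarᵇ y z))
  where
  xor-interchange : ∀ p r s t → (p xor r) xor (s xor t) ≡ (p xor s) xor (r xor t)
  xor-interchange = from-yes (∀B? λ p → ∀B? λ r → ∀B? λ s → ∀B? λ t →
    (p xor r) xor (s xor t) ≟B (p xor s) xor (r xor t))

scalarᵇ-linearʳ : (x y z : Word n) → scalarᵇ z (x ⊕ᵥ y) ≡ scalarᵇ z x xor scalarᵇ z y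
scalarᵇ-linearʳ x y z =
  trans (scalarᵇ-sym z (x ⊕ᵥ y)) (trans (scalarᵇ-linearˡ x y z) (cong₂ _xor_ (scalarᵇ-sym x z) (scalarᵇ-sym y z)))

scalarᵇ-self : (x : Word n) → scalarᵇ x x ≡ false
scalarᵇ-self [] = refl
scalarᵇ-self (a ∷ x) = cong₂ _xor_ (dotᵇ-self a) (scalarᵇ-self x)

scalarᵇ-zeroʳ : (x : Word n) → scalarᵇ x zeroW ≡ false
scalarᵇ-zeroʳ [] = refl
scalarᵇ-zeroʳ (a ∷ x) = cong₂ _xor_ (dotᵇ-zeroʳ a) (scalarᵇ-zeroʳ x)

scalarᵇ-zeroˡ : (y : Word n) → scalarᵇ zeroW y ≡ false
scalarᵇ-zeroˡ y = trans (scalarᵇ-sym zeroW y) (scalarᵇ-zeroʳ y)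

fullProd : {a b : ℕ} → Full A a → Full B b → Full (A × B) (a * b)
fullProd fa fb = card-⇔ (λ _ → mk⇔ _ _) (card-Σ-const {P = λ _ → ⊤} {Q = λ _ _ → ⊤} fa (λ _ _ → fb))

fullVec : {k : ℕ} → Full A k → (n : ℕ) → Full (Vec A n) (k ^ n)
fullVec fa zero = [] ∷ [] , [] ∷ [] , (λ { [] → mk⇔ _ (λ _ → here refl) }) , refl
fullVec fa (suc n) =
  card-inverse (λ (a , v) → a ∷ v) (λ { (a ∷ v) → a , v }) _ _ (λ { (a , v) _ → refl }) (λ { (a ∷ v) _ → refl })
    (fullProd fa (fullVec fa n))

fullWord : (n : ℕ) → Full (Word n) (4 ^ n)
fullWord = fullVec fullL

subsetCount : ℕ → ℕ
subsetCount zero = 2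
subsetCount (suc n) = subsetCount n * (subsetCount n * (subsetCount n * subsetCount n))

fullSubset : (n : ℕ) → Full (Subset n) (subsetCount n)
fullSubset zero = fullBool
fullSubset (suc n) = fullProd full (fullProd full (fullProd full full))
  where full = fullSubset n

_∈?_ : (x : Word n) (C : Subset n) → Dec (x ∈S C)
x ∈? C = member C x ≟B true

subset : (Word n → Bool) → Subset n
subset {zero} f = f []
subset {suc n} f = subset (λ x → f (𝟘 ∷ x)) , subset (λ x → f (𝟙 ∷ x)) , subset (λ x → f (ω ∷ x)) , subset (λ x → f (ω̄ ∷ x))

member-subset : (f : Word n → Bool) (x : Word n) → member (subset f) x ≡ f x
member-subset {zero} f [] = refl
member-subset {suc n} f (𝟘 ∷ x) = member-subset (λ x → f (𝟘 ∷ x)) x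
member-subset {suc n} f (𝟙 ∷ x) = member-subset (λ x → f (𝟙 ∷ x)) x
member-subset {suc n} f (ω ∷ x) = member-subset (λ x → f (ω ∷ x)) x
member-subset {suc n} f (ω̄ ∷ x) = member-subset (λ x → f (ω̄ ∷ x)) x

subset-ext : (C D : Subset n) → (∀ x → member C x ≡ member D x) → C ≡ D
subset-ext {zero} C D same = same []
subset-ext {suc n} (a , b , c , d) (a′ , b′ , c′ , d′) same =
  cong₂ _,_ (subset-ext a a′ (λ x → same (𝟘 ∷ x)))
   (cong₂ _,_ (subset-ext b b′ (λ x → same (𝟙 ∷ x)))
    (cong₂ _,_ (subset-ext c c′ (λ x → same (ω ∷ x))) (subset-ext d d′ (λ x → same (ω̄ ∷ x)))))

subset-ext⇔ : (C D : Subset n) → (∀ x → x ∈S C ⇔ x ∈S D) → C ≡ D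
subset-ext⇔ C D same = subset-ext C D (λ x → bool-ext (to (same x)) (from (same x)))
  where
  bool-ext : ∀ {p r : Bool} → (p ≡ true → r ≡ true) → (r ≡ true → p ≡ true) → p ≡ r
  bool-ext {true} f _ = sym (f refl)
  bool-ext {false} {true} _ g = g refl
  bool-ext {false} {false} _ _ = refl

_∋_∷_ : Subset (suc n) → L → Word n → Set
W ∋ a ∷ x = (a ∷ x) ∈S W

_∋?_∷_ : (W : Subset (suc n)) (a : L) (x : Word n) → Dec (W ∋ a ∷ x)
W ∋? a ∷ x = (a ∷ x) ∈? W

slice : Subset (suc n) → L → Subset n
slice W a = subset (λ x → member W (a ∷ x))

∈slice⇔ : (W : Subset (suc n)) (a : L) (x : Word n) → x ∈S slice W a ⇔ W ∋ a ∷ x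
∈slice⇔ W a x rewrite member-subset (λ x → member W (a ∷ x)) x = mk⇔ (λ p → p) (λ p → p)

Closed Isotropic Maximal : Subset n → Set
Closed {n} C = ∀ (x y : Word n) → x ∈S C → y ∈S C → (x ⊕ᵥ y) ∈S C
Isotropic {n} C = ∀ (x y : Word n) → x ∈S C → y ∈S C → scalarᵇ x y ≡ false
Maximal {n} C = ∀ (x : Word n) → (∀ (y : Word n) → y ∈S C → scalarᵇ x y ≡ false) → x ∈S C

record SD (C : Subset n) : Set where
  field
    zero∈ : zeroW ∈S C
    closed : Closed C
    isotropic : Isotropic C
    maximal : Maximal C

SelfDual⇔SD : (C : Subset n) → SelfDual C ⇔ SD C
SelfDual⇔SD C = mk⇔ forth back
  where
  forth : SelfDual C → SD C
  forth ((z , cl) , dual) = record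
    { zero∈ = z
    ; closed = cl
    ; isotropic = λ x y x∈ y∈ → to (scalar≡0⇔ x y) (to (dual x) x∈ y y∈)
    ; maximal = λ x ⊥C → from (dual x) (λ y y∈ → from (scalar≡0⇔ x y) (⊥C y y∈)) }
  back : SD C → SelfDual C
  back sd = (zero∈ , closed) ,
    (λ x → mk⇔ (λ x∈ y y∈ → from (scalar≡0⇔ x y) (isotropic x y x∈ y∈))
               (λ ⊥C → maximal x (λ y y∈ → to (scalar≡0⇔ x y) (⊥C y y∈))))
    where open SD sd

SD? : (C : Subset n) → Dec (SD C)
SD? {n} C = map′ (λ (z , c , i , m) → record { zero∈ = z ; closed = c ; isotropic = i ; maximal = m })
                 (λ sd → SD.zero∈ sd , SD.closed sd , SD.isotropic sd , SD.maximal sd)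
  ((zeroW ∈? C) ×-dec
   (∀W λ x → ∀W λ y → (x ∈? C) →-dec ((y ∈? C) →-dec ((x ⊕ᵥ y) ∈? C))) ×-dec
   (∀W λ x → ∀W λ y → (x ∈? C) →-dec ((y ∈? C) →-dec (scalarᵇ x y ≟B false))) ×-dec
   (∀W λ x → (∀W λ y → (y ∈? C) →-dec (scalarᵇ x y ≟B false)) →-dec (x ∈? C)))
  where
  ∀W : {P : Word n → Set} → Decidable P → Dec (∀ x → P x)
  ∀W = ∀? (fullWord n)

card-words : (W : Subset (suc n)) {k : ℕ} → HasCard (λ (a , x) → W ∋ a ∷ x) k → HasCard (_∈S W) k
card-words W = card-inverse (λ (a , x) → a ∷ x) (λ { (a ∷ x) → a , x })
  (λ _ w∈ → w∈) (λ { (a ∷ x) w∈ → w∈ }) (λ { (a , x) _ → refl }) (λ { (a ∷ x) _ → refl })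

scalarᵇ-∷𝟘 : (b : L) (x y : Word n) → scalarᵇ (b ∷ x) (𝟘 ∷ y) ≡ scalarᵇ x y
scalarᵇ-∷𝟘 b x y = cong (_xor scalarᵇ x y) (dotᵇ-zeroʳ b)

scalarᵇ-axisˡ : (a b : L) (x : Word n) → scalarᵇ (a ∷ zeroW) (b ∷ x) ≡ dotᵇ a b
scalarᵇ-axisˡ a b x = trans (cong (dotᵇ a b xor_) (scalarᵇ-zeroˡ x)) (Bool.xor-identityʳ (dotᵇ a b))

scalarᵇ-axisʳ : (a b : L) (x : Word n) → scalarᵇ (a ∷ x) (b ∷ zeroW) ≡ dotᵇ a b
scalarᵇ-axisʳ a b x = trans (cong (dotᵇ a b xor_) (scalarᵇ-zeroʳ x)) (Bool.xor-identityʳ (dotᵇ a b))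

-- Split codes: W contains (a, 0, …, 0) for some a ≠ 0; then W = {0,a} × S

spanned : L → L → Bool
spanned a b = ⌊ b ≟L 𝟘 ⌋ ∨ ⌊ b ≟L a ⌋

spanned⇔orthogonal : ∀ a b → ¬ a ≡ 𝟘 → spanned a b ≡ not (dotᵇ a b)
spanned⇔orthogonal = from-yes (∀L? λ a → ∀L? λ b → ¬? (a ≟L 𝟘) →-dec (spanned a b ≟B not (dotᵇ a b)))

spanned-cases : ∀ a b → spanned a b ≡ true → b ≡ 𝟘 ⊎ b ≡ a
spanned-cases a b _ with b ≟L 𝟘 | b ≟L a
... | yes b≡0 | _ = inj₁ b≡0
... | no _ | yes b≡a = inj₂ b≡a

spanned-closed : ∀ a b c → spanned a b ≡ true → spanned a c ≡ true → spanned a (b ⊕ c) ≡ true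
spanned-closed = from-yes (∀L? λ a → ∀L? λ b → ∀L? λ c →
  (spanned a b ≟B true) →-dec ((spanned a c ≟B true) →-dec (spanned a (b ⊕ c) ≟B true)))

spanned-isotropic : ∀ a b c → spanned a b ≡ true → spanned a c ≡ true → dotᵇ b c ≡ false
spanned-isotropic = from-yes (∀L? λ a → ∀L? λ b → ∀L? λ c →
  (spanned a b ≟B true) →-dec ((spanned a c ≟B true) →-dec (dotᵇ b c ≟B false)))

spanned-zero : ∀ a → spanned a 𝟘 ≡ true
spanned-zero = from-yes (∀L? λ a → spanned a 𝟘 ≟B true)

spanned-self : ∀ a → spanned a a ≡ true
spanned-self = from-yes (∀L? λ a → spanned a a ≟B true)

split : L → Subset n → Subset (suc n)
split a S = subset λ { (b ∷ x) → spanned a b ∧ member S x }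

∈split⇔ : ∀ a (S : Subset n) b x → split a S ∋ b ∷ x ⇔ (spanned a b ≡ true × x ∈S S)
∈split⇔ a S b x rewrite member-subset (λ { (b ∷ x) → spanned a b ∧ member S x }) (b ∷ x)
  with spanned a b | member S x
... | true | true = mk⇔ (λ _ → refl , refl) (λ _ → refl)
... | true | false = mk⇔ (λ ()) (λ ())
... | false | _ = mk⇔ (λ ()) (λ ())

SplitSD : Subset (suc n) → Set
SplitSD W = SD W × Σ L (λ a → ¬ a ≡ 𝟘 × W ∋ a ∷ zeroW)

split-SD : ∀ {a} {S : Subset n} → ¬ a ≡ 𝟘 → SD S → SD (split a S)
split-SD {a = a} {S} a≢0 sdS = record
  { zero∈ = into 𝟘 zeroW (spanned-zero a) zero∈
  ; closed = λ { (b ∷ x) (c ∷ y) p q →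
      into (b ⊕ c) (x ⊕ᵥ y) (spanned-closed a b c (line b x p) (line c y q)) (closed x y (rest b x p) (rest c y q)) }
  ; isotropic = λ { (b ∷ x) (c ∷ y) p q →
      cong₂ _xor_ (spanned-isotropic a b c (line b x p) (line c y q)) (isotropic x y (rest b x p) (rest c y q)) }
  ; maximal = λ { (b ∷ x) ⊥W → into b x (orthogonal-to-a b x ⊥W)
      (maximal x (λ y y∈ → trans (sym (scalarᵇ-∷𝟘 b x y)) (⊥W (𝟘 ∷ y) (into 𝟘 y (spanned-zero a) y∈)))) }
  }
  where
  open SD sdS
  into : ∀ b x → spanned a b ≡ true → x ∈S S → split a S ∋ b ∷ x
  into b x p q = from (∈split⇔ a S b x) (p , q)
  line : ∀ b x → split a S ∋ b ∷ x → spanned a b ≡ true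
  line b x p = proj₁ (to (∈split⇔ a S b x) p)
  rest : ∀ b x → split a S ∋ b ∷ x → x ∈S S
  rest b x p = proj₂ (to (∈split⇔ a S b x) p)
  orthogonal-to-a : ∀ b x → (∀ w → w ∈S split a S → scalarᵇ (b ∷ x) w ≡ false) → spanned a b ≡ true
  orthogonal-to-a b x ⊥W = begin
    spanned a b                       ≡⟨ spanned⇔orthogonal a b a≢0 ⟩
    not (dotᵇ a b)                    ≡⟨ cong not (dotᵇ-sym a b) ⟩
    not (dotᵇ b a)                    ≡⟨ cong not (sym (scalarᵇ-axisʳ b a x)) ⟩
    not (scalarᵇ (b ∷ x) (a ∷ zeroW)) ≡⟨ cong not (⊥W (a ∷ zeroW) (into a zeroW (spanned-self a) zero∈)) ⟩
    true ∎
    where open ≡-Reasoning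

module SplitStructure {W : Subset (suc n)} (sdW : SD W) {a : L} (a≢0 : ¬ a ≡ 𝟘) (a∈W : W ∋ a ∷ zeroW) where
  open SD sdW

  -- every first coordinate is orthogonal to a, i.e. lies in {0, a}
  first-spanned : ∀ b x → W ∋ b ∷ x → spanned a b ≡ true
  first-spanned b x p = begin
    spanned a b                       ≡⟨ spanned⇔orthogonal a b a≢0 ⟩
    not (dotᵇ a b)                    ≡⟨ cong not (sym (scalarᵇ-axisˡ a b x)) ⟩
    not (scalarᵇ (a ∷ zeroW) (b ∷ x)) ≡⟨ cong not (isotropic (a ∷ zeroW) (b ∷ x) a∈W p) ⟩
    true ∎
    where open ≡-Reasoning

  shift : ∀ b x → W ∋ b ∷ x → W ∋ (a ⊕ b) ∷ x
  shift b x p = subst (λ v → W ∋ (a ⊕ b) ∷ v) (⊕ᵥ-identityˡ x) (closed (a ∷ zeroW) (b ∷ x) a∈W p)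

  slice-invariant : ∀ b x → spanned a b ≡ true → W ∋ b ∷ x ⇔ W ∋ 𝟘 ∷ x
  slice-invariant b x b∈⟨a⟩ with spanned-cases a b b∈⟨a⟩
  ... | inj₁ refl = mk⇔ (λ p → p) (λ p → p)
  ... | inj₂ refl = mk⇔ (λ p → subst (λ c → W ∋ c ∷ x) (⊕-self a) (shift a x p))
                        (λ p → subst (λ c → W ∋ c ∷ x) (⊕-identityʳ a) (shift 𝟘 x p))

  ∈W⇔ : ∀ b x → W ∋ b ∷ x ⇔ (spanned a b ≡ true × x ∈S slice W 𝟘)
  ∈W⇔ b x = mk⇔
    (λ p → first-spanned b x p , from (∈slice⇔ W 𝟘 x) (to (slice-invariant b x (first-spanned b x p)) p))
    (λ (s , p) → from (slice-invariant b x s) (to (∈slice⇔ W 𝟘 x) p))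

  W≡split : W ≡ split a (slice W 𝟘)
  W≡split = subset-ext⇔ W _ λ { (b ∷ x) → ⇔.trans (∈W⇔ b x) (⇔.sym (∈split⇔ a (slice W 𝟘) b x)) }

  slice-SD : SD (slice W 𝟘)
  slice-SD = record
    { zero∈ = into zeroW zero∈
    ; closed = λ x y p q → into (x ⊕ᵥ y) (closed (𝟘 ∷ x) (𝟘 ∷ y) (out x p) (out y q))
    ; isotropic = λ x y p q → isotropic (𝟘 ∷ x) (𝟘 ∷ y) (out x p) (out y q)
    ; maximal = λ x ⊥S → into x (maximal (𝟘 ∷ x) λ { (c ∷ y) q →
        ⊥S y (proj₂ (to (∈W⇔ c y) q)) }) }
    where
    into : ∀ x → W ∋ 𝟘 ∷ x → x ∈S slice W 𝟘
    into x = from (∈slice⇔ W 𝟘 x)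
    out : ∀ x → x ∈S slice W 𝟘 → W ∋ 𝟘 ∷ x
    out x = to (∈slice⇔ W 𝟘 x)

slice-split : ∀ a (S : Subset n) → slice (split a S) 𝟘 ≡ S
slice-split a S = subset-ext⇔ _ S λ x → ⇔.trans (∈slice⇔ (split a S) 𝟘 x)
  (⇔.trans (∈split⇔ a S 𝟘 x) (mk⇔ proj₂ (spanned-zero a ,_)))

nonzeroL : HasCard (λ (a : L) → ¬ a ≡ 𝟘) 3
nonzeroL = card-compl fullL (_≟L 𝟘) (𝟘 ∷ [] , [] ∷ [] , (λ a → mk⇔ (λ { (here a≡0) → a≡0 ; (there ()) }) here) , refl)

count-split : {k : ℕ} → HasCard (SD {n}) k → HasCard (SplitSD {n}) (3 * k)
count-split {n} sd-count =
  card-image (λ (a , S) → split a S) injective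
    (λ (a , S) (a≢0 , sdS) → split-SD a≢0 sdS , a , a≢0 , from (∈split⇔ a S a zeroW) (spanned-self a , SD.zero∈ sdS))
    (λ W (sdW , a , a≢0 , a∈W) → (a , slice W 𝟘) , (a≢0 , SplitStructure.slice-SD sdW a≢0 a∈W) ,
                                  sym (SplitStructure.W≡split sdW a≢0 a∈W))
    (card-Σ-const {P = λ a → ¬ a ≡ 𝟘} {Q = λ _ S → SD S} nonzeroL (λ _ _ → sd-count))
  where
  injective : ∀ {(a , S) (a′ , S′) : L × Subset n} → ¬ a ≡ 𝟘 × SD S → ¬ a′ ≡ 𝟘 × SD S′ →
    split a S ≡ split a′ S′ → (a , S) ≡ (a′ , S′)
  injective {a , S} {a′ , S′} (a≢0 , sdS) _ same = cong₂ _,_ a≡a′ S≡S′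
    where
    a∈ : spanned a′ a ≡ true
    a∈ = proj₁ (to (∈split⇔ a′ S′ a zeroW)
                   (subst (λ W → W ∋ a ∷ zeroW) same (from (∈split⇔ a S a zeroW) (spanned-self a , SD.zero∈ sdS))))
    a≡a′ : a ≡ a′
    a≡a′ with spanned-cases a′ a a∈
    ... | inj₁ a≡0 = ⊥-elim (a≢0 a≡0)
    ... | inj₂ a≡a′ = a≡a′
    S≡S′ : S ≡ S′
    S≡S′ = trans (sym (slice-split a S)) (trans (cong (λ W → slice W 𝟘) same) (slice-split a′ S′))

-- Glued codes

Unsplit : Subset (suc n) → Set
Unsplit W = ∀ a → ¬ a ≡ 𝟘 → ¬ W ∋ a ∷ zeroW

GluedSD : Subset (suc n) → Set
GluedSD W = SD W × Unsplit W

-- L = {0,1} ⊔ {ω, ω̄}; isω a decides the second part (it is a·1).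
isω : L → Bool
isω a = dotᵇ a 𝟙

ωᵇ : Bool → L
ωᵇ true = ω
ωᵇ false = ω̄

lift : Bool → L
lift true = 𝟙
lift false = 𝟘

infixr 7 _·ᴸ_
_·ᴸ_ : Bool → L → L
true ·ᴸ a = a
false ·ᴸ a = 𝟘

infixr 25 _·ᵥ_
_·ᵥ_ : Bool → Word n → Word n
true ·ᵥ x = x
false ·ᵥ x = zeroW

isω-ωᵇ : ∀ b → isω (ωᵇ b) ≡ true
isω-ωᵇ = from-yes (∀B? λ b → isω (ωᵇ b) ≟B true)

isω-lift : ∀ p → isω (lift p) ≡ false
isω-lift = from-yes (∀B? λ p → isω (lift p) ≟B false)

isω-linear : ∀ a c → isω (a ⊕ c) ≡ isω a xor isω c
isω-linear a c = dotᵇ-linear a c 𝟙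

dotᵇ-lift : ∀ p a → dotᵇ (lift p) a ≡ p ∧ isω a
dotᵇ-lift = from-yes (∀B? λ p → ∀L? λ a → dotᵇ (lift p) a ≟B p ∧ isω a)

low-isotropic : ∀ e c → isω e ≡ false → isω c ≡ false → dotᵇ e c ≡ false
low-isotropic = from-yes (∀L? λ e → ∀L? λ c → (isω e ≟B false) →-dec ((isω c ≟B false) →-dec (dotᵇ e c ≟B false)))

low-cases : ∀ e → isω e ≡ false → e ≡ 𝟘 ⊎ e ≡ 𝟙
low-cases = from-yes (∀L? λ e → (isω e ≟B false) →-dec ((e ≟L 𝟘) ⊎-dec (e ≟L 𝟙)))

low-nonzero : ∀ b a → ¬ a ≡ 𝟘 → isω a ≡ false → dotᵇ a (ωᵇ b) ≡ true
low-nonzero = from-yes (∀B? λ b → ∀L? λ a → ¬? (a ≟L 𝟘) →-dec ((isω a ≟B false) →-dec (dotᵇ a (ωᵇ b) ≟B true)))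

remove-ω-part : ∀ b a → isω (a ⊕ isω a ·ᴸ ωᵇ b) ≡ false
remove-ω-part = from-yes (∀B? λ b → ∀L? λ a → isω (a ⊕ isω a ·ᴸ ωᵇ b) ≟B false)

reconstruct : ∀ b e a → isω e ≡ false → dotᵇ e (ωᵇ b) ≡ dotᵇ a (ωᵇ b) → e ⊕ isω a ·ᴸ ωᵇ b ≡ a
reconstruct = from-yes (∀B? λ b → ∀L? λ e → ∀L? λ a →
  (isω e ≟B false) →-dec ((dotᵇ e (ωᵇ b) ≟B dotᵇ a (ωᵇ b)) →-dec (e ⊕ isω a ·ᴸ ωᵇ b ≟L a)))

-- The identity behind the isotropy of glued codes.
glue-identity : ∀ b a c → dotᵇ a c xor ((isω c ∧ dotᵇ a (ωᵇ b)) xor (isω a ∧ dotᵇ c (ωᵇ b))) ≡ false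
glue-identity = from-yes (∀B? λ b → ∀L? λ a → ∀L? λ c →
  dotᵇ a c xor ((isω c ∧ dotᵇ a (ωᵇ b)) xor (isω a ∧ dotᵇ c (ωᵇ b))) ≟B false)

whichω : L → Bool
whichω a = ⌊ a ≟L ω ⌋

ωᵇ-whichω : ∀ a → isω a ≡ true → ωᵇ (whichω a) ≡ a
ωᵇ-whichω = from-yes (∀L? λ a → (isω a ≟B true) →-dec (ωᵇ (whichω a) ≟L a))

isω-⊕ωᵇ : ∀ b a → isω (a ⊕ ωᵇ b) ≡ not (isω a)
isω-⊕ωᵇ = from-yes (∀B? λ b → ∀L? λ a → isω (a ⊕ ωᵇ b) ≟B not (isω a))

whichω-ωᵇ : ∀ b → whichω (ωᵇ b) ≡ b
whichω-ωᵇ = from-yes (∀B? λ b → whichω (ωᵇ b) ≟B b)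

·ᵥ-∷ : ∀ p a (x : Word n) → p ·ᵥ (a ∷ x) ≡ (p ·ᴸ a) ∷ (p ·ᵥ x)
·ᵥ-∷ true a x = refl
·ᵥ-∷ false a x = refl

·ᵥ-xor : ∀ p r (y : Word n) → p ·ᵥ y ⊕ᵥ r ·ᵥ y ≡ (p xor r) ·ᵥ y
·ᵥ-xor true true y = ⊕ᵥ-self y
·ᵥ-xor true false y = ⊕ᵥ-identityʳ y
·ᵥ-xor false r y = ⊕ᵥ-identityˡ (r ·ᵥ y)

scalarᵇ-·ᵥ : ∀ p (x y : Word n) → scalarᵇ x (p ·ᵥ y) ≡ p ∧ scalarᵇ x y
scalarᵇ-·ᵥ true x y = refl
scalarᵇ-·ᵥ false x y = scalarᵇ-zeroʳ x

multiple-∈ : {C : Subset n} → zeroW ∈S C → ∀ p w → w ∈S C → (p ·ᵥ w) ∈S C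
multiple-∈ z true w w∈ = w∈
multiple-∈ z false w w∈ = z

scalarᵇ-shifted : ∀ p r (u u′ y : Word n) →
  scalarᵇ (u ⊕ᵥ p ·ᵥ y) (u′ ⊕ᵥ r ·ᵥ y) ≡ scalarᵇ u u′ xor ((r ∧ scalarᵇ u y) xor (p ∧ scalarᵇ u′ y))
scalarᵇ-shifted p r u u′ y = begin
  scalarᵇ (u ⊕ᵥ p ·ᵥ y) (u′ ⊕ᵥ r ·ᵥ y)
    ≡⟨ scalarᵇ-linearˡ u (p ·ᵥ y) _ ⟩
  scalarᵇ u (u′ ⊕ᵥ r ·ᵥ y) xor scalarᵇ (p ·ᵥ y) (u′ ⊕ᵥ r ·ᵥ y)
    ≡⟨ cong₂ _xor_ (scalarᵇ-linearʳ u′ (r ·ᵥ y) u) (scalarᵇ-linearʳ u′ (r ·ᵥ y) (p ·ᵥ y)) ⟩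
  (scalarᵇ u u′ xor scalarᵇ u (r ·ᵥ y)) xor (scalarᵇ (p ·ᵥ y) u′ xor scalarᵇ (p ·ᵥ y) (r ·ᵥ y))
    ≡⟨ cong₂ (λ v w → (scalarᵇ u u′ xor v) xor w) (scalarᵇ-·ᵥ r u y)
             (cong₂ _xor_ (trans (scalarᵇ-sym (p ·ᵥ y) u′) (scalarᵇ-·ᵥ p u′ y)) (multiples-isotropic p r)) ⟩
  (scalarᵇ u u′ xor (r ∧ scalarᵇ u y)) xor ((p ∧ scalarᵇ u′ y) xor false)
    ≡⟨ xor-rearrange (scalarᵇ u u′) (r ∧ scalarᵇ u y) (p ∧ scalarᵇ u′ y) ⟩
  scalarᵇ u u′ xor ((r ∧ scalarᵇ u y) xor (p ∧ scalarᵇ u′ y)) ∎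
  where
  open ≡-Reasoning
  multiples-isotropic : ∀ p r → scalarᵇ (p ·ᵥ y) (r ·ᵥ y) ≡ false
  multiples-isotropic p r = begin
    scalarᵇ (p ·ᵥ y) (r ·ᵥ y) ≡⟨ scalarᵇ-·ᵥ r (p ·ᵥ y) y ⟩
    r ∧ scalarᵇ (p ·ᵥ y) y    ≡⟨ cong (r ∧_) (scalarᵇ-sym (p ·ᵥ y) y) ⟩
    r ∧ scalarᵇ y (p ·ᵥ y)    ≡⟨ cong (r ∧_) (scalarᵇ-·ᵥ p y y) ⟩
    r ∧ (p ∧ scalarᵇ y y)     ≡⟨ cong (λ v → r ∧ (p ∧ v)) (scalarᵇ-self y) ⟩
    r ∧ (p ∧ false)           ≡⟨ cong (r ∧_) (∧-zeroʳ p) ⟩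
    r ∧ false                 ≡⟨ ∧-zeroʳ r ⟩
    false ∎
  xor-rearrange : ∀ s v w → (s xor v) xor (w xor false) ≡ s xor (v xor w)
  xor-rearrange = from-yes (∀B? λ s → ∀B? λ v → ∀B? λ w → (s xor v) xor (w xor false) ≟B s xor (v xor w))

glue : Subset n → Word n → Bool → Subset (suc n)
glue C y b = subset λ { (a ∷ x) → member C (x ⊕ᵥ isω a ·ᵥ y) ∧ ⌊ scalarᵇ x y ≟B dotᵇ a (ωᵇ b) ⌋ }

∈glue⇔ : ∀ (C : Subset n) y b a x →
  glue C y b ∋ a ∷ x ⇔ ((x ⊕ᵥ isω a ·ᵥ y) ∈S C × scalarᵇ x y ≡ dotᵇ a (ωᵇ b))
∈glue⇔ C y b a x
  rewrite member-subset (λ { (a ∷ x) → member C (x ⊕ᵥ isω a ·ᵥ y) ∧ ⌊ scalarᵇ x y ≟B dotᵇ a (ωᵇ b) ⌋ }) (a ∷ x)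
  with member C (x ⊕ᵥ isω a ·ᵥ y) | scalarᵇ x y ≟B dotᵇ a (ωᵇ b)
... | true | yes e = mk⇔ (λ _ → refl , e) (λ _ → refl)
... | true | no ¬e = mk⇔ (λ ()) (λ (_ , e) → ⊥-elim (¬e e))
... | false | _ = mk⇔ (λ ()) (λ ())

module Glue {C : Subset n} (sdC : SD C) (y : Word n) (b : Bool) where
  open SD sdC
  private
    t = ωᵇ b
    W = glue C y b

  residue-word : ∀ a x → W ∋ a ∷ x → (x ⊕ᵥ isω a ·ᵥ y) ∈S C
  residue-word a x p = proj₁ (to (∈glue⇔ C y b a x) p)

  pairing : ∀ a x → W ∋ a ∷ x → scalarᵇ x y ≡ dotᵇ a t
  pairing a x p = proj₂ (to (∈glue⇔ C y b a x) p)

  pairing-residue : ∀ a x → W ∋ a ∷ x → scalarᵇ (x ⊕ᵥ isω a ·ᵥ y) y ≡ dotᵇ a t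
  pairing-residue a x p = begin
    scalarᵇ (x ⊕ᵥ isω a ·ᵥ y) y          ≡⟨ scalarᵇ-linearˡ x (isω a ·ᵥ y) y ⟩
    scalarᵇ x y xor scalarᵇ (isω a ·ᵥ y) y ≡⟨ cong (scalarᵇ x y xor_) (trans (scalarᵇ-sym _ y) (trans (scalarᵇ-·ᵥ (isω a) y y) (cong (isω a ∧_) (scalarᵇ-self y)))) ⟩
    scalarᵇ x y xor (isω a ∧ false)      ≡⟨ cong (scalarᵇ x y xor_) (∧-zeroʳ (isω a)) ⟩
    scalarᵇ x y xor false                ≡⟨ Bool.xor-identityʳ _ ⟩
    scalarᵇ x y                          ≡⟨ pairing a x p ⟩
    dotᵇ a t ∎
    where open ≡-Reasoning

  into : ∀ a x → (x ⊕ᵥ isω a ·ᵥ y) ∈S C → scalarᵇ x y ≡ dotᵇ a t → W ∋ a ∷ x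
  into a x p e = from (∈glue⇔ C y b a x) (p , e)

  glue-∋ : W ∋ t ∷ y
  glue-∋ = into t y (subst (λ v → v ∈S C) (sym (trans (cong (λ p → y ⊕ᵥ p ·ᵥ y) (isω-ωᵇ b)) (⊕ᵥ-self y))) zero∈)
                    (trans (scalarᵇ-self y) (sym (dotᵇ-self t)))

  glue-closed : Closed W
  glue-closed (a ∷ x) (a′ ∷ x′) p q = into (a ⊕ a′) (x ⊕ᵥ x′) sum∈C sum-pairing
    where
    sum∈C : ((x ⊕ᵥ x′) ⊕ᵥ isω (a ⊕ a′) ·ᵥ y) ∈S C
    sum∈C = subst (λ v → v ∈S C)
      (trans (⊕ᵥ-interchange x (isω a ·ᵥ y) x′ (isω a′ ·ᵥ y))
             (cong ((x ⊕ᵥ x′) ⊕ᵥ_) (trans (·ᵥ-xor (isω a) (isω a′) y) (cong (_·ᵥ y) (sym (isω-linear a a′))))))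
      (closed _ _ (residue-word a x p) (residue-word a′ x′ q))
    sum-pairing : scalarᵇ (x ⊕ᵥ x′) y ≡ dotᵇ (a ⊕ a′) t
    sum-pairing = trans (scalarᵇ-linearˡ x x′ y)
      (trans (cong₂ _xor_ (pairing a x p) (pairing a′ x′ q)) (sym (dotᵇ-linear a a′ t)))

  glue-isotropic : Isotropic W
  glue-isotropic (a ∷ x) (a′ ∷ x′) p q = begin
    dotᵇ a a′ xor scalarᵇ x x′
      ≡⟨ cong₂ (λ v w → dotᵇ a a′ xor scalarᵇ v w) (sym (⊕ᵥ-cancel x (isω a ·ᵥ y))) (sym (⊕ᵥ-cancel x′ (isω a′ ·ᵥ y))) ⟩
    dotᵇ a a′ xor scalarᵇ (u ⊕ᵥ isω a ·ᵥ y) (u′ ⊕ᵥ isω a′ ·ᵥ y)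
      ≡⟨ cong (dotᵇ a a′ xor_) (scalarᵇ-shifted (isω a) (isω a′) u u′ y) ⟩
    dotᵇ a a′ xor (scalarᵇ u u′ xor ((isω a′ ∧ scalarᵇ u y) xor (isω a ∧ scalarᵇ u′ y)))
      ≡⟨ cong₂ (λ v w → dotᵇ a a′ xor (v xor w)) (isotropic u u′ (residue-word a x p) (residue-word a′ x′ q))
               (cong₂ (λ v w → (isω a′ ∧ v) xor (isω a ∧ w)) (pairing-residue a x p) (pairing-residue a′ x′ q)) ⟩
    dotᵇ a a′ xor ((isω a′ ∧ dotᵇ a t) xor (isω a ∧ dotᵇ a′ t))
      ≡⟨ glue-identity b a a′ ⟩
    false ∎
    where
    open ≡-Reasoning
    u = x ⊕ᵥ isω a ·ᵥ y
    u′ = x′ ⊕ᵥ isω a′ ·ᵥ y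

  lifted-∈ : ∀ c → c ∈S C → W ∋ lift (scalarᵇ c y) ∷ c
  lifted-∈ c c∈ = into (lift p) c (subst (λ v → v ∈S C) (sym c⊕0≡c) c∈) (sym lift·t)
    where
    p = scalarᵇ c y
    c⊕0≡c : c ⊕ᵥ isω (lift p) ·ᵥ y ≡ c
    c⊕0≡c = trans (cong (λ r → c ⊕ᵥ r ·ᵥ y) (isω-lift p)) (⊕ᵥ-identityʳ c)
    lift·t : dotᵇ (lift p) t ≡ p
    lift·t = trans (dotᵇ-lift p t) (trans (cong (p ∧_) (isω-ωᵇ b)) (Bool.∧-identityʳ p))

  glue-maximal : Maximal W
  glue-maximal (a ∷ x) ⊥W = into a x (maximal u u⊥C) (sym (xor≡false⇒≡ (dotᵇ a t) _ (⊥W (t ∷ y) glue-∋)))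
    where
    u = x ⊕ᵥ isω a ·ᵥ y
    u⊥C : ∀ c → c ∈S C → scalarᵇ u c ≡ false
    u⊥C c c∈ = begin
      scalarᵇ u c                              ≡⟨ scalarᵇ-linearˡ x (isω a ·ᵥ y) c ⟩
      scalarᵇ x c xor scalarᵇ (isω a ·ᵥ y) c    ≡⟨ cong (scalarᵇ x c xor_) (trans (scalarᵇ-sym _ c) (scalarᵇ-·ᵥ (isω a) c y)) ⟩
      scalarᵇ x c xor (isω a ∧ scalarᵇ c y)     ≡⟨ Bool.xor-comm (scalarᵇ x c) _ ⟩
      (isω a ∧ scalarᵇ c y) xor scalarᵇ x c     ≡⟨ cong (_xor scalarᵇ x c) a·lift ⟩
      dotᵇ a (lift (scalarᵇ c y)) xor scalarᵇ x c ≡⟨ ⊥W (lift (scalarᵇ c y) ∷ c) (lifted-∈ c c∈) ⟩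
      false ∎
      where
      open ≡-Reasoning
      a·lift : isω a ∧ scalarᵇ c y ≡ dotᵇ a (lift (scalarᵇ c y))
      a·lift = trans (Bool.∧-comm (isω a) _) (sym (trans (dotᵇ-sym a _) (dotᵇ-lift _ a)))

  glue-SD : SD W
  glue-SD = record
    { zero∈ = into 𝟘 zeroW (subst (λ v → v ∈S C) (sym (⊕ᵥ-identityˡ zeroW)) zero∈) (scalarᵇ-zeroˡ y)
    ; closed = glue-closed
    ; isotropic = glue-isotropic
    ; maximal = glue-maximal }

  glue-glued : ¬ y ∈S C → Unsplit W
  glue-glued y∉C a a≢0 p with isω a in isω-a
  ... | true = y∉C (subst (λ v → v ∈S C) (⊕ᵥ-identityˡ y)
                     (subst (λ r → (zeroW ⊕ᵥ r ·ᵥ y) ∈S C) isω-a (residue-word a zeroW p)))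
  ... | false with () ← trans (sym (low-nonzero b a a≢0 isω-a)) (trans (sym (pairing a zeroW p)) (scalarᵇ-zeroˡ y))

residue : Subset (suc n) → Subset n
residue W = subset λ x → member W (𝟘 ∷ x) ∨ member W (𝟙 ∷ x)

∈residue⇔ : ∀ (W : Subset (suc n)) x → x ∈S residue W ⇔ Σ L (λ e → isω e ≡ false × W ∋ e ∷ x)
∈residue⇔ W x rewrite member-subset (λ x → member W (𝟘 ∷ x) ∨ member W (𝟙 ∷ x)) x =
  mk⇔ forth back
  where
  forth : member W (𝟘 ∷ x) ∨ member W (𝟙 ∷ x) ≡ true → Σ L (λ e → isω e ≡ false × W ∋ e ∷ x)
  forth p with member W (𝟘 ∷ x) in 0∈
  ... | true = 𝟘 , refl , 0∈
  ... | false = 𝟙 , refl , p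
  back : Σ L (λ e → isω e ≡ false × W ∋ e ∷ x) → member W (𝟘 ∷ x) ∨ member W (𝟙 ∷ x) ≡ true
  back (e , low , e∈) with low-cases e low
  ... | inj₁ refl = cong (_∨ member W (𝟙 ∷ x)) e∈
  ... | inj₂ refl = trans (cong (member W (𝟘 ∷ x) ∨_) e∈) (∨-zeroʳ _)

module _ {C : Subset n} (sdC : SD C) (y : Word n) (b : Bool) where
  open Glue sdC y b

  residue-glue : residue (glue C y b) ≡ C
  residue-glue = subset-ext⇔ _ C λ x → ⇔.trans (∈residue⇔ (glue C y b) x) (mk⇔ forth (λ x∈ → lift (scalarᵇ x y) , isω-lift (scalarᵇ x y) , lifted-∈ x x∈))
    where
    forth : ∀ {x} → Σ L (λ e → isω e ≡ false × glue C y b ∋ e ∷ x) → x ∈S C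
    forth {x} (e , low , e∈) =
      subst (λ v → v ∈S C) (trans (cong (λ p → x ⊕ᵥ p ·ᵥ y) low) (⊕ᵥ-identityʳ x)) (residue-word e x e∈)

module GluedStructure {W : Subset (suc n)} (sdW : SD W) (glued : Unsplit W)
                      (b : Bool) {y : Word n} (t∈W : W ∋ ωᵇ b ∷ y) where
  open SD sdW
  private
    t = ωᵇ b

  first-unique : ∀ a a′ x → W ∋ a ∷ x → W ∋ a′ ∷ x → a ≡ a′
  first-unique a a′ x p q with a ⊕ a′ ≟L 𝟘
  ... | yes a⊕a′≡0 = ⊕≡𝟘⇒≡ a a′ a⊕a′≡0
  ... | no a⊕a′≢0 = ⊥-elim (glued (a ⊕ a′) a⊕a′≢0
          (subst (λ v → W ∋ (a ⊕ a′) ∷ v) (⊕ᵥ-self x) (closed (a ∷ x) (a′ ∷ x) p q)))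

  add-multiple : ∀ p a x → W ∋ a ∷ x → W ∋ (a ⊕ p ·ᴸ t) ∷ (x ⊕ᵥ p ·ᵥ y)
  add-multiple p a x a∈ = subst (_∈S W) (cong ((a ∷ x) ⊕ᵥ_) (·ᵥ-∷ p t y))
    (closed (a ∷ x) (p ·ᵥ (t ∷ y)) a∈ (multiple-∈ zero∈ p (t ∷ y) t∈W))

  reduce : ∀ a x → W ∋ a ∷ x → W ∋ (a ⊕ isω a ·ᴸ t) ∷ (x ⊕ᵥ isω a ·ᵥ y)
  reduce a = add-multiple (isω a) a

  reduce-∈residue : ∀ a x → W ∋ a ∷ x → (x ⊕ᵥ isω a ·ᵥ y) ∈S residue W
  reduce-∈residue a x p = from (∈residue⇔ W _) (a ⊕ isω a ·ᴸ t , remove-ω-part b a , reduce a x p)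

  -- orthogonality to (t, y)
  pairing : ∀ a x → W ∋ a ∷ x → scalarᵇ x y ≡ dotᵇ a t
  pairing a x p = sym (xor≡false⇒≡ (dotᵇ a t) _ (isotropic (a ∷ x) (t ∷ y) p t∈W))

  -- the first coordinate of y is t ∉ {0,1}
  y∉residue : ¬ y ∈S residue W
  y∉residue y∈ with to (∈residue⇔ W y) y∈
  ... | (e , low , e∈) with () ← trans (sym low) (trans (cong isω (first-unique e t y e∈ t∈W)) (isω-ωᵇ b))

  residue-SD : SD (residue W)
  residue-SD = record
    { zero∈ = into 𝟘 zeroW refl zero∈
    ; closed = λ x x′ p q → let (e , low , e∈) = out x p ; (e′ , low′ , e′∈) = out x′ q in
        into (e ⊕ e′) (x ⊕ᵥ x′) (trans (isω-linear e e′) (cong₂ _xor_ low low′)) (closed (e ∷ x) (e′ ∷ x′) e∈ e′∈)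
    ; isotropic = λ x x′ p q → let (e , low , e∈) = out x p ; (e′ , low′ , e′∈) = out x′ q in
        trans (cong (_xor scalarᵇ x x′) (sym (low-isotropic e e′ low low′))) (isotropic (e ∷ x) (e′ ∷ x′) e∈ e′∈)
    ; maximal = residue-maximal }
    where
    into : ∀ e x → isω e ≡ false → W ∋ e ∷ x → x ∈S residue W
    into e x low e∈ = from (∈residue⇔ W x) (e , low , e∈)
    out : ∀ x → x ∈S residue W → Σ L (λ e → isω e ≡ false × W ∋ e ∷ x)
    out x = to (∈residue⇔ W x)
    residue-maximal : Maximal (residue W)
    residue-maximal x ⊥R = into (lift p) x (isω-lift p) (maximal (lift p ∷ x) ⊥W)
      where
      p = scalarᵇ x y
      ⊥W : ∀ w → w ∈S W → scalarᵇ (lift p ∷ x) w ≡ false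
      ⊥W (a ∷ x′) q = begin
        dotᵇ (lift p) a xor scalarᵇ x x′ ≡⟨ cong₂ _xor_ (dotᵇ-lift p a) x·x′ ⟩
        (p ∧ isω a) xor (isω a ∧ p)      ≡⟨ cong ((p ∧ isω a) xor_) (Bool.∧-comm (isω a) p) ⟩
        (p ∧ isω a) xor (p ∧ isω a)      ≡⟨ xor-same (p ∧ isω a) ⟩
        false ∎
        where
        open ≡-Reasoning
        x·x′ : scalarᵇ x x′ ≡ isω a ∧ p
        x·x′ = xor≡false⇒≡ _ _ (trans (trans (cong (scalarᵇ x x′ xor_) (sym (scalarᵇ-·ᵥ (isω a) x y)))
                                             (sym (scalarᵇ-linearʳ x′ (isω a ·ᵥ y) x)))
                                      (⊥R _ (reduce-∈residue a x′ q)))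

  glue-residue : glue (residue W) y b ≡ W
  glue-residue = subset-ext⇔ _ W λ { (a ∷ x) → mk⇔ (forth a x) (back a x) }
    where
    open Glue residue-SD y b using (residue-word; pairing-residue)
    back : ∀ a x → W ∋ a ∷ x → glue (residue W) y b ∋ a ∷ x
    back a x p = from (∈glue⇔ (residue W) y b a x) (reduce-∈residue a x p , pairing a x p)
    forth : ∀ a x → glue (residue W) y b ∋ a ∷ x → W ∋ a ∷ x
    forth a x p with to (∈residue⇔ W _) (residue-word a x p)
    ... | (e , low , e∈) = subst₂ (λ c v → W ∋ c ∷ v) e⊕≡a (⊕ᵥ-cancel x (isω a ·ᵥ y)) (add-multiple (isω a) e z e∈)
      where
      z = x ⊕ᵥ isω a ·ᵥ y
      e⊕≡a : e ⊕ isω a ·ᴸ t ≡ a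
      e⊕≡a = reconstruct b e a low (trans (sym (pairing e z e∈)) (pairing-residue a x p))

glued-has-ω-word : {W : Subset (suc n)} → SD W → Unsplit W →
  Σ (Word n × Bool) (λ (y , b) → W ∋ ωᵇ b ∷ y)
glued-has-ω-word {n} {W} sdW glued with ∃? (fullProd (fullWord n) fullBool) (λ (y , b) → W ∋? ωᵇ b ∷ y)
... | yes found = found
... | no none = ⊥-elim (glued 𝟙 (λ ()) (SD.maximal sdW (𝟙 ∷ zeroW) orthogonal))
  where
  -- otherwise (1, 0, …, 0) would be orthogonal to W
  orthogonal : ∀ w → w ∈S W → scalarᵇ (𝟙 ∷ zeroW) w ≡ false
  orthogonal (a ∷ x) a∈ with isω a in isω-a
  ... | true = ⊥-elim (none ((x , whichω a) , subst (λ c → W ∋ c ∷ x) (sym (ωᵇ-whichω a isω-a)) a∈))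
  ... | false = trans (scalarᵇ-axisˡ 𝟙 a x) (low-isotropic 𝟙 a refl isω-a)

split-or-glued : {W : Subset (suc n)} → SD W → SplitSD W ⊎ GluedSD W
split-or-glued {W = W} sdW with ∃? fullL (λ a → ¬? (a ≟L 𝟘) ×-dec (W ∋? a ∷ zeroW))
... | yes axis = inj₁ (sdW , axis)
... | no no-axis = inj₂ (sdW , λ a a≢0 a∈ → no-axis (a , a≢0 , a∈))

-- Self-dual codes of length n have 2^n words

spanned-count : ∀ a → ¬ a ≡ 𝟘 → HasCard (λ b → spanned a b ≡ true) 2
spanned-count a a≢0 = 𝟘 ∷ a ∷ [] , ((λ 0≡a → a≢0 (sym 0≡a)) ∷ []) ∷ [] ∷ [] ,
  (λ b → mk⇔ (listed b) (spanning b)) , refl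
  where
  listed : ∀ b → b ∈ 𝟘 ∷ a ∷ [] → spanned a b ≡ true
  listed _ (here refl) = spanned-zero a
  listed _ (there (here refl)) = spanned-self a
  spanning : ∀ b → spanned a b ≡ true → b ∈ 𝟘 ∷ a ∷ []
  spanning b s with spanned-cases a b s
  ... | inj₁ refl = here refl
  ... | inj₂ refl = there (here refl)

split-size : ∀ {a} {S : Subset n} {m} → ¬ a ≡ 𝟘 → HasCard (_∈S S) m → HasCard (_∈S split a S) (2 * m)
split-size {a = a} {S} a≢0 cardS = card-words (split a S)
  (card-⇔ (λ (b , x) → ⇔.sym (∈split⇔ a S b x))
    (card-Σ-const {P = λ b → spanned a b ≡ true} {Q = λ _ x → x ∈S S} (spanned-count a a≢0) (λ _ _ → cardS)))

-- In a glued code the words with first coordinate in {0,1} correspond to the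
-- residue, and translation by (t, y) exchanges them with the remaining words.
module GluedCount {W : Subset (suc n)} (sdW : SD W) (glued : Unsplit W)
                  (size-n : ∀ (C : Subset n) → SD C → HasCard (_∈S C) (2 ^ n)) where
  private
    y = proj₁ (proj₁ (glued-has-ω-word sdW glued))
    b = proj₂ (proj₁ (glued-has-ω-word sdW glued))
    t = ωᵇ b
  open GluedStructure sdW glued b (proj₂ (glued-has-ω-word sdW glued))

  Low High : L × Word n → Set
  Low (a , x) = isω a ≡ false × W ∋ a ∷ x
  High (a , x) = isω a ≡ true × W ∋ a ∷ x

  -- (a, x) ↦ x is a bijection from the {0,1}-part onto the residue
  low-count : HasCard Low (2 ^ n)
  low-count = card-preimage (fullProd fullL (fullWord n)) (λ (a , x) → (isω a ≟B false) ×-dec (W ∋? a ∷ x)) proj₂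
    (λ {(a , x)} {(a′ , x′)} (_ , a∈) (_ , a′∈) x≡x′ →
       cong₂ _,_ (first-unique a a′ x a∈ (subst (λ v → W ∋ a′ ∷ v) (sym x≡x′) a′∈)) x≡x′)
    (λ (a , x) low∈ → from (∈residue⇔ W x) (a , low∈))
    (λ x x∈ → let (e , low , e∈) = to (∈residue⇔ W x) x∈ in (e , x) , (low , e∈) , refl)
    (size-n (residue W) residue-SD)

  -- adding (t, y) exchanges the two parts
  high-count : HasCard High (2 ^ n)
  high-count = card-inverse translate translate
    (λ (a , x) (low , a∈) → trans (isω-⊕ωᵇ b a) (cong not low) , add-multiple true a x a∈)
    (λ (a , x) (high , a∈) → trans (isω-⊕ωᵇ b a) (cong not high) , add-multiple true a x a∈)
    (λ (a , x) _ → cong₂ _,_ (⊕-cancel a t) (⊕ᵥ-cancel x y))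
    (λ (a , x) _ → cong₂ _,_ (⊕-cancel a t) (⊕ᵥ-cancel x y))
    low-count
    where
    translate : L × Word n → L × Word n
    translate (a , x) = a ⊕ t , x ⊕ᵥ y

  size : HasCard (_∈S W) (2 ^ suc n)
  size = card-words W (card-⇔ (λ (a , x) → mk⇔ (λ { (inj₁ (_ , a∈)) → a∈ ; (inj₂ (_ , a∈)) → a∈ }) (split-by-isω a x))
                               (subst (HasCard _) (cong (2 ^ n +_) (sym (+-identityʳ (2 ^ n))))
                                 (card-⊎ low-count high-count (λ _ (low , _) (high , _) → true≢false (trans (sym high) low)))))
    where
    true≢false : ¬ true ≡ false
    true≢false ()
    split-by-isω : ∀ a x → W ∋ a ∷ x → Low (a , x) ⊎ High (a , x)
    split-by-isω a x a∈ with isω a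
    ... | false = inj₁ (refl , a∈)
    ... | true = inj₂ (refl , a∈)

  ω-words : HasCard (λ (y , b) → W ∋ ωᵇ b ∷ y) (2 ^ n)
  ω-words = card-inverse (λ (a , x) → x , whichω a) (λ (y , b) → ωᵇ b , y)
    (λ (a , x) (high , a∈) → subst (λ c → W ∋ c ∷ x) (sym (ωᵇ-whichω a high)) a∈)
    (λ (y , b) ω∈ → isω-ωᵇ b , ω∈)
    (λ (a , x) (high , _) → cong (_, x) (ωᵇ-whichω a high))
    (λ (y , b) _ → cong (y ,_) (whichω-ωᵇ b))
    high-count

sd-size : ∀ n (C : Subset n) → SD C → HasCard (_∈S C) (2 ^ n)
sd-size zero C sdC = [] ∷ [] , [] ∷ [] , (λ { [] → mk⇔ (λ _ → SD.zero∈ sdC) (λ _ → here refl) }) , refl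
sd-size (suc n) W sdW with split-or-glued sdW
... | inj₁ (_ , a , a≢0 , a∈W) =
  subst (λ V → HasCard (_∈S V) (2 ^ suc n)) (sym W≡split) (split-size a≢0 (sd-size n (slice W 𝟘) slice-SD))
  where open SplitStructure sdW a≢0 a∈W
... | inj₂ (_ , glued) = GluedCount.size sdW glued (sd-size n)

-- The number of self-dual codes

-- Glued codes with a marked word (ωᵇ b, y) correspond to self-dual codes of
-- length n with a marked word y outside and a bit b.
module GluedPairs (n : ℕ) where

  CodeWithOutsider : Subset n × (Word n × Bool) → Set
  CodeWithOutsider (C , (y , _)) = SD C × ¬ y ∈S C

  GluedWithωWord : Subset (suc n) × (Word n × Bool) → Set
  GluedWithωWord (W , (y , b)) = GluedSD W × W ∋ ωᵇ b ∷ y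

  -- |SD n| · (4^n − 2^n) · 2 such triples, since |C| = 2^n
  outsider-count : {P : ℕ} → HasCard (SD {n}) P → HasCard CodeWithOutsider (P * ((4 ^ n ∸ 2 ^ n) * 2))
  outsider-count sd-count =
    card-⇔ (λ _ → mk⇔ (λ (sdC , y∉C , _) → sdC , y∉C) (λ (sdC , y∉C) → sdC , y∉C , tt))
      (card-Σ-const {P = SD} {Q = λ C (y , _) → ¬ y ∈S C × ⊤} sd-count λ C sdC →
        card-Σ-const {Q = λ _ _ → ⊤} (card-compl (fullWord n) (_∈? C) (sd-size n C sdC)) (λ _ _ → fullBool))

  glued-ω-count : {T : ℕ} → HasCard (GluedSD {n}) T → HasCard GluedWithωWord (T * 2 ^ n)
  glued-ω-count glued-count =
    card-Σ-const {P = GluedSD} {Q = λ W (y , b) → W ∋ ωᵇ b ∷ y} glued-count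
      (λ W (sdW , glued) → GluedCount.ω-words sdW glued (sd-size n))

  glue-bijection : {k : ℕ} → HasCard CodeWithOutsider k → HasCard GluedWithωWord k
  glue-bijection = card-inverse (λ (C , (y , b)) → glue C y b , (y , b)) (λ (W , yb) → residue W , yb)
    (λ (C , (y , b)) (sdC , y∉C) → (Glue.glue-SD sdC y b , Glue.glue-glued sdC y b y∉C) , Glue.glue-∋ sdC y b)
    (λ (W , (y , b)) ((sdW , glued) , t∈W) →
       GluedStructure.residue-SD sdW glued b t∈W , GluedStructure.y∉residue sdW glued b t∈W)
    (λ (C , (y , b)) (sdC , _) → cong (_, (y , b)) (residue-glue sdC y b))
    (λ (W , (y , b)) ((sdW , glued) , t∈W) → cong (_, (y , b)) (GluedStructure.glue-residue sdW glued b t∈W))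

  double-count : {P T : ℕ} → HasCard (SD {n}) P → HasCard (GluedSD {n}) T →
    T * 2 ^ n ≡ P * ((4 ^ n ∸ 2 ^ n) * 2)
  double-count sd-count glued-count =
    card-unique (glued-ω-count glued-count) (glue-bijection (outsider-count sd-count))

4^n≡2^n*2^n : ∀ n → 4 ^ n ≡ 2 ^ n * 2 ^ n
4^n≡2^n*2^n zero = refl
4^n≡2^n*2^n (suc n) = trans (cong (4 *_) (4^n≡2^n*2^n n)) (square-double (2 ^ n))
  where
  square-double : ∀ m → 4 * (m * m) ≡ (2 * m) * (2 * m)
  square-double = solve-∀

recursion-arithmetic : ∀ n P T → T * 2 ^ n ≡ P * ((4 ^ n ∸ 2 ^ n) * 2) → 3 * P + T ≡ P * (2 ^ suc n + 1)
recursion-arithmetic n P T double = begin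
  3 * P + T                  ≡⟨ cong (3 * P +_) T≡ ⟩
  3 * P + P * (k * 2)        ≡⟨ finish P k ⟩
  P * (2 * suc k + 1)        ≡⟨ cong (λ m → P * (2 * m + 1)) 1+k≡2^n ⟩
  P * (2 ^ suc n + 1) ∎
  where
  open ≡-Reasoning
  k = pred (2 ^ n)
  1+k≡2^n : suc k ≡ 2 ^ n
  1+k≡2^n = suc-pred (2 ^ n) ⦃ >-nonZero (m^n>0 2 n) ⦄
  4^n∸2^n : 4 ^ n ∸ 2 ^ n ≡ k * suc k
  4^n∸2^n = begin
    4 ^ n ∸ 2 ^ n               ≡⟨ cong (_∸ 2 ^ n) (4^n≡2^n*2^n n) ⟩
    2 ^ n * 2 ^ n ∸ 2 ^ n       ≡⟨ cong (λ m → m * m ∸ m) (sym 1+k≡2^n) ⟩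
    suc k + k * suc k ∸ suc k   ≡⟨ m+n∸m≡n (suc k) (k * suc k) ⟩
    k * suc k ∎
  T≡ : T ≡ P * (k * 2)
  T≡ = *-cancelʳ-≡ T (P * (k * 2)) (suc k) (begin
    T * suc k                   ≡⟨ cong (T *_) 1+k≡2^n ⟩
    T * 2 ^ n                   ≡⟨ double ⟩
    P * ((4 ^ n ∸ 2 ^ n) * 2)   ≡⟨ cong (λ m → P * (m * 2)) 4^n∸2^n ⟩
    P * ((k * suc k) * 2)       ≡⟨ regroup P k ⟩
    P * (k * 2) * suc k ∎)
    where
    regroup : ∀ P k → P * ((k * suc k) * 2) ≡ P * (k * 2) * suc k
    regroup = solve-∀
  finish : ∀ P k → 3 * P + P * (k * 2) ≡ P * (2 * suc k + 1)
  finish = solve-∀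

sd-count-zero : HasCard (SD {0}) 1
sd-count-zero = true ∷ [] , [] ∷ [] , (λ C → mk⇔ (listed C) (λ sdC → here (SD.zero∈ sdC))) , refl
  where
  listed : ∀ C → C ∈ true ∷ [] → SD C
  listed _ (here refl) = record
    { zero∈ = refl ; closed = λ { [] [] _ _ → refl } ; isotropic = λ { [] [] _ _ → refl } ; maximal = λ { [] _ → refl } }

GluedSD? : (W : Subset (suc n)) → Dec (GluedSD W)
GluedSD? W = SD? W ×-dec ∀? fullL (λ a → ¬? (a ≟L 𝟘) →-dec ¬? (W ∋? a ∷ zeroW))

sd-count : ∀ n → HasCard (SD {n}) (prodFormula n)
sd-count zero = sd-count-zero
sd-count (suc n) =
  subst (HasCard SD) recursion
    (card-⇔ split⊎glued (card-⊎ (count-split (sd-count n)) glued-count disjoint))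
  where
  T : ℕ
  T = proj₁ (card-filter (fullSubset (suc n)) GluedSD?)
  glued-count : HasCard GluedSD T
  glued-count = proj₂ (card-filter (fullSubset (suc n)) GluedSD?)
  split⊎glued : ∀ W → (SplitSD W ⊎ GluedSD W) ⇔ SD W
  split⊎glued W = mk⇔ [ proj₁ , proj₁ ]′ split-or-glued
  disjoint : ∀ W → SplitSD W → GluedSD W → ⊥
  disjoint W (_ , a , a≢0 , a∈) (_ , glued) = glued a a≢0 a∈
  recursion : 3 * prodFormula n + T ≡ prodFormula (suc n)
  recursion = recursion-arithmetic n (prodFormula n) T (GluedPairs.double-count n (sd-count n) glued-count)

selfDual-count : ∀ n → HasCard (SelfDual {n}) (prodFormula n)
selfDual-count n = card-⇔ (λ C → ⇔.sym (SelfDual⇔SD C)) (sd-count n)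

fullFin : (m : ℕ) → Full (Fin m) m
fullFin m = allFin m , Unique.allFin⁺ m , (λ i → mk⇔ _ (λ _ → ∈-allFin i)) , length-tabulate (λ i → i)

Injective : {m k : ℕ} → Vec (Fin m) k → Set
Injective {k = k} v = ∀ (i j : Fin k) → lookup v i ≡ lookup v j → i ≡ j

Image : {m k : ℕ} → Vec (Fin m) k → Fin m → Set
Image {k = k} v j = Σ (Fin k) (λ i → lookup v i ≡ j)

Image? : {m k : ℕ} (v : Vec (Fin m) k) → Decidable (Image v)
Image? {k = k} v j = ∃? (fullFin k) (λ i → lookup v i Fin.≟ j)

non-image-count : {m k : ℕ} (v : Vec (Fin m) k) → Injective v → HasCard (λ j → ¬ Image v j) (m ∸ k)
non-image-count {m} {k} v inj = card-compl (fullFin m) (Image? v)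
  (card-image (lookup v) (λ {i} {j} _ _ → inj i j) (λ i _ → i , refl) (λ j (i , e) → i , tt , e) (fullFin k))

falling : ℕ → ℕ → ℕ
falling m zero = 1
falling m (suc k) = falling m k * (m ∸ k)

-- There are m (m−1) ⋯ (m−k+1) injective vectors Fin k → Fin m: extend an
-- injective vector of length k by one of the m − k points outside its image.
injective-count : ∀ m k → HasCard (Injective {m} {k}) (falling m k)
injective-count m zero = [] ∷ [] , [] ∷ [] , (λ { [] → mk⇔ (λ _ ()) (λ _ → here refl) }) , refl
injective-count m (suc k) =
  card-image (λ (v , j) → j ∷ v) (λ { {v , j} {v′ , j′} _ _ refl → refl }) (λ (v , j) (inj , j∉) → extend v j inj j∉)
    (λ { (j ∷ v) inj → (v , j) , (restrict inj , λ (i , e) → 0≢suc (inj Fin.zero (Fin.suc i) (sym e))) , refl })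
    (card-Σ-const {P = Injective} {Q = λ v j → ¬ Image v j} (injective-count m k) non-image-count)
  where
  0≢suc : ∀ {i : Fin k} → ¬ Fin.zero ≡ Fin.suc i
  0≢suc ()
  restrict : ∀ {j} {v : Vec (Fin m) k} → Injective (j ∷ v) → Injective v
  restrict inj i i′ e = Fin.suc-injective (inj (Fin.suc i) (Fin.suc i′) e)
  extend : (v : Vec (Fin m) k) (j : Fin m) → Injective v → ¬ Image v j → Injective (j ∷ v)
  extend v j inj j∉ Fin.zero Fin.zero e = refl
  extend v j inj j∉ Fin.zero (Fin.suc i) e = ⊥-elim (j∉ (i , sym e))
  extend v j inj j∉ (Fin.suc i) Fin.zero e = ⊥-elim (j∉ (i , e))
  extend v j inj j∉ (Fin.suc i) (Fin.suc i′) e = cong Fin.suc (inj i i′ e)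

falling-suc : ∀ m k → falling (suc m) (suc k) ≡ suc m * falling m k
falling-suc m zero = trans (*-identityˡ (suc m)) (sym (*-identityʳ (suc m)))
falling-suc m (suc k) = trans (cong (_* (m ∸ k)) (falling-suc m k)) (*-assoc (suc m) (falling m k) (m ∸ k))

falling-n-n : ∀ n → falling n n ≡ n !
falling-n-n zero = refl
falling-n-n (suc n) = trans (falling-suc n n) (cong (suc n *_) (falling-n-n n))

permutation-count : ∀ n → HasCard (IsPerm {n}) (n !)
permutation-count n = subst (HasCard _) (falling-n-n n) (injective-count n n)

-- An injective self-map of Fin n is onto: its complement has n − n = 0 points.
perm-onto : ∀ {n} (π : Vec (Fin n) n) → IsPerm π → ∀ j → Image π j
perm-onto {n} π π-perm j with Image? π j
... | yes j∈ = j∈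
... | no j∉ with non-image-count π π-perm
...   | (l , _ , mem , len) = ⊥-elim (empty l (trans len (n∸n≡0 n)) (from (mem j) j∉))
  where
  empty : (l : List (Fin n)) → length l ≡ 0 → j ∈ l → ⊥
  empty [] _ ()

-- The group G = S₂ⁿ : Sₙ acting on L^n

swapω-xor : ∀ p r a → swapω p (swapω r a) ≡ swapω (p xor r) a
swapω-xor = from-yes (∀B? λ p → ∀B? λ r → ∀L? λ a → swapω p (swapω r a) ≟L swapω (p xor r) a)

swapω-⊕ : ∀ p a c → swapω p (a ⊕ c) ≡ swapω p a ⊕ swapω p c
swapω-⊕ = from-yes (∀B? λ p → ∀L? λ a → ∀L? λ c → swapω p (a ⊕ c) ≟L swapω p a ⊕ swapω p c)

swapω-dotᵇ : ∀ p a c → dotᵇ (swapω p a) (swapω p c) ≡ dotᵇ a c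
swapω-dotᵇ = from-yes (∀B? λ p → ∀L? λ a → ∀L? λ c → dotᵇ (swapω p a) (swapω p c) ≟B dotᵇ a c)

swapω-zero : ∀ p → swapω p 𝟘 ≡ 𝟘
swapω-zero = from-yes (∀B? λ p → swapω p 𝟘 ≟L 𝟘)

swapω-false : ∀ a → swapω false a ≡ a
swapω-false = from-yes (∀L? λ a → swapω false a ≟L a)

sign : Elt n → Fin n → Bool
sign (s , _) = lookup s

perm : Elt n → Fin n → Fin n
perm (_ , π) = lookup π

vec-ext : {u v : Vec A n} → (∀ i → lookup u i ≡ lookup v i) → u ≡ v
vec-ext {u = u} {v} same = trans (sym (tabulate∘lookup u)) (trans (tabulate-cong same) (tabulate∘lookup v))

Elt-ext : (g h : Elt n) → (∀ i → sign g i ≡ sign h i) → (∀ i → perm g i ≡ perm h i) → g ≡ h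
Elt-ext (s , π) (t , ρ) same-sign same-perm = cong₂ _,_ (vec-ext same-sign) (vec-ext same-perm)

lookup-act : (g : Elt n) (x : Word n) (i : Fin n) → lookup (act g x) i ≡ swapω (sign g i) (lookup x (perm g i))
lookup-act (s , π) x = lookup∘tabulate _

-- composition, chosen so that g · h acts as "first h, then g"
infixl 7 _·_
_·_ : Elt n → Elt n → Elt n
g · h = tabulate (λ i → sign g i xor sign h (perm g i)) , tabulate (λ i → perm h (perm g i))

sign-· : (g h : Elt n) (i : Fin n) → sign (g · h) i ≡ sign g i xor sign h (perm g i)
sign-· g h = lookup∘tabulate _

perm-· : (g h : Elt n) (i : Fin n) → perm (g · h) i ≡ perm h (perm g i)
perm-· g h = lookup∘tabulate _

idG : Elt n
idG {n} = replicate n false , tabulate (λ i → i)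

sign-id : (i : Fin n) → sign idG i ≡ false
sign-id i = lookup-replicate i false

perm-id : (i : Fin n) → perm idG i ≡ i
perm-id = lookup∘tabulate (λ i → i)

·-perm : (g h : Elt n) → InG g → InG h → InG (g · h)
·-perm g h g-perm h-perm i j e =
  g-perm i j (h-perm _ _ (trans (sym (perm-· g h i)) (trans e (perm-· g h j))))

id-perm : InG (idG {n})
id-perm i j e = trans (sym (perm-id i)) (trans e (perm-id j))

·-assoc : (a b c : Elt n) → (a · b) · c ≡ a · (b · c)
·-assoc a b c = Elt-ext _ _
  (λ i → begin
    sign ((a · b) · c) i                                         ≡⟨ sign-· (a · b) c i ⟩
    sign (a · b) i xor sign c (perm (a · b) i)                   ≡⟨ cong₂ (λ u v → u xor sign c v) (sign-· a b i) (perm-· a b i) ⟩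
    (sign a i xor sign b (perm a i)) xor sign c (perm b (perm a i)) ≡⟨ xor-assoc (sign a i) _ _ ⟩
    sign a i xor (sign b (perm a i) xor sign c (perm b (perm a i))) ≡⟨ cong (sign a i xor_) (sym (sign-· b c (perm a i))) ⟩
    sign a i xor sign (b · c) (perm a i)                         ≡⟨ sym (sign-· a (b · c) i) ⟩
    sign (a · (b · c)) i ∎)
  (λ i → begin
    perm ((a · b) · c) i         ≡⟨ perm-· (a · b) c i ⟩
    perm c (perm (a · b) i)      ≡⟨ cong (perm c) (perm-· a b i) ⟩
    perm c (perm b (perm a i))   ≡⟨ sym (perm-· b c (perm a i)) ⟩
    perm (b · c) (perm a i)      ≡⟨ sym (perm-· a (b · c) i) ⟩
    perm (a · (b · c)) i ∎)
  where open ≡-Reasoning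

·-identityˡ : (h : Elt n) → idG · h ≡ h
·-identityˡ h = Elt-ext _ _
  (λ i → trans (sign-· idG h i) (cong₂ (λ u v → u xor sign h v) (sign-id i) (perm-id i)))
  (λ i → trans (perm-· idG h i) (cong (perm h) (perm-id i)))

act-· : (g h : Elt n) (x : Word n) → act (g · h) x ≡ act g (act h x)
act-· g h x = vec-ext λ i → begin
  lookup (act (g · h) x) i                                          ≡⟨ lookup-act (g · h) x i ⟩
  swapω (sign (g · h) i) (lookup x (perm (g · h) i))                ≡⟨ cong₂ (λ u v → swapω u (lookup x v)) (sign-· g h i) (perm-· g h i) ⟩
  swapω (sign g i xor sign h (perm g i)) (lookup x (perm h (perm g i))) ≡⟨ sym (swapω-xor (sign g i) _ _) ⟩
  swapω (sign g i) (swapω (sign h (perm g i)) (lookup x (perm h (perm g i)))) ≡⟨ cong (swapω (sign g i)) (sym (lookup-act h x (perm g i))) ⟩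
  swapω (sign g i) (lookup (act h x) (perm g i))                    ≡⟨ sym (lookup-act g (act h x) i) ⟩
  lookup (act g (act h x)) i ∎
  where open ≡-Reasoning

act-id : (x : Word n) → act idG x ≡ x
act-id x = vec-ext λ i → trans (lookup-act idG x i)
  (trans (cong₂ (λ u v → swapω u (lookup x v)) (sign-id i) (perm-id i)) (swapω-false (lookup x i)))

-- The inverse of g = (s, π): (s ∘ π⁻¹, π⁻¹), where π⁻¹ exists since an
-- injective self-map of Fin n is onto.
module Inverse (g : Elt n) (g-perm : InG g) where

  π⁻¹ : Fin n → Fin n
  π⁻¹ j = proj₁ (perm-onto (proj₂ g) g-perm j)

  perm-π⁻¹ : ∀ j → perm g (π⁻¹ j) ≡ j
  perm-π⁻¹ j = proj₂ (perm-onto (proj₂ g) g-perm j)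

  π⁻¹-perm : ∀ i → π⁻¹ (perm g i) ≡ i
  π⁻¹-perm i = g-perm _ _ (perm-π⁻¹ (perm g i))

  inv : Elt n
  inv = tabulate (λ j → sign g (π⁻¹ j)) , tabulate π⁻¹

  sign-inv : ∀ j → sign inv j ≡ sign g (π⁻¹ j)
  sign-inv = lookup∘tabulate _

  perm-inv : ∀ j → perm inv j ≡ π⁻¹ j
  perm-inv = lookup∘tabulate _

  inv-perm : InG inv
  inv-perm i j e = trans (sym (perm-π⁻¹ i)) (trans (cong (perm g) e′) (perm-π⁻¹ j))
    where e′ = trans (sym (perm-inv i)) (trans e (perm-inv j))

  ·-inverseˡ : inv · g ≡ idG
  ·-inverseˡ = Elt-ext _ _
    (λ i → begin
      sign (inv · g) i                        ≡⟨ sign-· inv g i ⟩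
      sign inv i xor sign g (perm inv i)      ≡⟨ cong₂ (λ u v → u xor sign g v) (sign-inv i) (perm-inv i) ⟩
      sign g (π⁻¹ i) xor sign g (π⁻¹ i)       ≡⟨ xor-same (sign g (π⁻¹ i)) ⟩
      false                                   ≡⟨ sym (sign-id i) ⟩
      sign idG i ∎)
    (λ i → trans (perm-· inv g i) (trans (cong (perm g) (perm-inv i)) (trans (perm-π⁻¹ i) (sym (perm-id i)))))
    where open ≡-Reasoning

  ·-inverseʳ : g · inv ≡ idG
  ·-inverseʳ = Elt-ext _ _
    (λ i → begin
      sign (g · inv) i                        ≡⟨ sign-· g inv i ⟩
      sign g i xor sign inv (perm g i)        ≡⟨ cong (sign g i xor_) (trans (sign-inv (perm g i)) (cong (sign g) (π⁻¹-perm i))) ⟩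
      sign g i xor sign g i                   ≡⟨ xor-same (sign g i) ⟩
      false                                   ≡⟨ sym (sign-id i) ⟩
      sign idG i ∎)
    (λ i → trans (perm-· g inv i) (trans (perm-inv (perm g i)) (trans (π⁻¹-perm i) (sym (perm-id i)))))
    where open ≡-Reasoning

  act-inverseˡ : ∀ x → act inv (act g x) ≡ x
  act-inverseˡ x = trans (sym (act-· inv g x)) (trans (cong (λ k → act k x) ·-inverseˡ) (act-id x))

  act-inverseʳ : ∀ x → act g (act inv x) ≡ x
  act-inverseʳ x = trans (sym (act-· g inv x)) (trans (cong (λ k → act k x) ·-inverseʳ) (act-id x))

act-⊕ : (g : Elt n) (x y : Word n) → act g (x ⊕ᵥ y) ≡ act g x ⊕ᵥ act g y
act-⊕ g x y = vec-ext λ i → begin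
  lookup (act g (x ⊕ᵥ y)) i                                   ≡⟨ lookup-act g (x ⊕ᵥ y) i ⟩
  swapω (sign g i) (lookup (x ⊕ᵥ y) (perm g i))               ≡⟨ cong (swapω (sign g i)) (lookup-zipWith _⊕_ (perm g i) x y) ⟩
  swapω (sign g i) (lookup x (perm g i) ⊕ lookup y (perm g i)) ≡⟨ swapω-⊕ (sign g i) _ _ ⟩
  swapω (sign g i) (lookup x (perm g i)) ⊕ swapω (sign g i) (lookup y (perm g i))
    ≡⟨ sym (cong₂ _⊕_ (lookup-act g x i) (lookup-act g y i)) ⟩
  lookup (act g x) i ⊕ lookup (act g y) i                     ≡⟨ sym (lookup-zipWith _⊕_ i (act g x) (act g y)) ⟩
  lookup (act g x ⊕ᵥ act g y) i ∎
  where open ≡-Reasoning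

act-zero : (g : Elt n) → act g zeroW ≡ zeroW
act-zero g = vec-ext λ i → trans (lookup-act g zeroW i)
  (trans (cong (swapω (sign g i)) (lookup-replicate (perm g i) 𝟘)) (trans (swapω-zero (sign g i)) (sym (lookup-replicate i 𝟘))))

module F₂Sum = MonoidSum (CommutativeRing.+-commutativeMonoid xor-∧-commutativeRing)

-- scalarᵇ as a sum over the coordinates, which G permutes.
scalarᵇ-sum : (x y : Word n) → scalarᵇ x y ≡ F₂Sum.sum (λ i → dotᵇ (lookup x i) (lookup y i))
scalarᵇ-sum [] [] = refl
scalarᵇ-sum (a ∷ x) (b ∷ y) = cong (dotᵇ a b xor_) (scalarᵇ-sum x y)

act-scalarᵇ : (g : Elt n) → InG g → (x y : Word n) → scalarᵇ (act g x) (act g y) ≡ scalarᵇ x y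
act-scalarᵇ {n} g g-perm x y = begin
  scalarᵇ (act g x) (act g y)                                        ≡⟨ scalarᵇ-sum (act g x) (act g y) ⟩
  F₂Sum.sum (λ i → dotᵇ (lookup (act g x) i) (lookup (act g y) i))
    ≡⟨ F₂Sum.sum-cong-≗ (λ i → trans (cong₂ dotᵇ (lookup-act g x i) (lookup-act g y i)) (swapω-dotᵇ (sign g i) _ _)) ⟩
  F₂Sum.sum (λ i → f (perm g i))                                     ≡⟨ sym (F₂Sum.sum-permute f π) ⟩
  F₂Sum.sum f                                                        ≡⟨ sym (scalarᵇ-sum x y) ⟩
  scalarᵇ x y ∎
  where
  open ≡-Reasoning
  open Inverse g g-perm using (π⁻¹; perm-π⁻¹; π⁻¹-perm)
  f : Fin n → Bool
  f j = dotᵇ (lookup x j) (lookup y j)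
  π = permutation (perm g) π⁻¹ perm-π⁻¹ π⁻¹-perm

group-count : ∀ n → HasCard (InG {n}) (2 ^ n * n !)
group-count n = card-⇔ (λ _ → mk⇔ proj₂ (tt ,_))
  (card-Σ-const {P = λ _ → ⊤} {Q = λ _ π → IsPerm π} (fullVec fullBool n) (λ _ _ → permutation-count n))

Transports : Elt n → Subset n → Subset n → Set
Transports {n} g C D = ∀ (x : Word n) → x ∈S C ⇔ act g x ∈S D

module _ (g : Elt n) (g-perm : InG g) where
  open Inverse g g-perm

  mapsTo⇔transports : ∀ {C D} → MapsTo g C D ⇔ Transports g C D
  mapsTo⇔transports {C} {D} = mk⇔ forth back
    where
    forth : MapsTo g C D → Transports g C D
    forth M x = mk⇔ (λ x∈ → to (M _) (x , x∈ , refl)) λ gx∈ →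
      let (x′ , x′∈ , gx′≡gx) = from (M _) gx∈ in
      subst (_∈S C) (trans (sym (act-inverseˡ x′)) (trans (cong (act inv) gx′≡gx) (act-inverseˡ x))) x′∈
    back : Transports g C D → MapsTo g C D
    back T y = mk⇔ (λ (x , x∈ , gx≡y) → subst (_∈S D) gx≡y (to (T x) x∈))
      (λ y∈ → act inv y , from (T _) (subst (_∈S D) (sym (act-inverseʳ y)) y∈) , act-inverseʳ y)

  transports-inverse : ∀ {C D} → Transports g C D → Transports inv D C
  transports-inverse {C} {D} T y = ⇔.trans (≡⇒⇔ (cong (_∈S D) (sym (act-inverseʳ y)))) (⇔.sym (T (act inv y)))
    where
    ≡⇒⇔ : {X Y : Set} → X ≡ Y → X ⇔ Y
    ≡⇒⇔ refl = ⇔.refl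

  transports-unique : ∀ {C D D′} → Transports g C D → Transports g C D′ → D ≡ D′
  transports-unique T T′ = subset-ext⇔ _ _ λ y → ⇔.trans (transports-inverse T y) (⇔.sym (transports-inverse T′ y))

  image : Subset n → Subset n
  image C = subset λ y → member C (act inv y)

  transports-image : ∀ C → Transports g C (image C)
  transports-image C x rewrite member-subset (λ y → member C (act inv y)) (act g x) | act-inverseˡ x = ⇔.refl

  SD-transport : ∀ {C D} → Transports g C D → SD C → SD D
  SD-transport {C} {D} T sdC = record
    { zero∈ = subst (_∈S D) (act-zero g) (to (T zeroW) zero∈)
    ; closed = λ x y x∈ y∈ → from (T⁻¹ (x ⊕ᵥ y))
        (subst (_∈S C) (sym (act-⊕ inv x y)) (closed _ _ (to (T⁻¹ x) x∈) (to (T⁻¹ y) y∈)))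
    ; isotropic = λ x y x∈ y∈ → trans (sym (act-scalarᵇ inv inv-perm x y)) (isotropic _ _ (to (T⁻¹ x) x∈) (to (T⁻¹ y) y∈))
    ; maximal = λ x ⊥D → from (T⁻¹ x) (maximal (act inv x) λ c c∈ → begin
        scalarᵇ (act inv x) c                 ≡⟨ cong (scalarᵇ (act inv x)) (sym (act-inverseˡ c)) ⟩
        scalarᵇ (act inv x) (act inv (act g c)) ≡⟨ act-scalarᵇ inv inv-perm x (act g c) ⟩
        scalarᵇ x (act g c)                   ≡⟨ ⊥D (act g c) (to (T c) c∈) ⟩
        false ∎) }
    where
    open SD sdC
    open ≡-Reasoning
    T⁻¹ = transports-inverse T

transports-· : (g h : Elt n) {C D E : Subset n} → Transports g C D → Transports h D E → Transports (h · g) C E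
transports-· g h {E = E} T T′ x =
  ⇔.trans (T x) (⇔.trans (T′ (act g x)) (subst (λ v → act h (act g x) ∈S E ⇔ v ∈S E) (sym (act-· h g x)) ⇔.refl))

transports-id : (C : Subset n) → Transports idG C C
transports-id C x = subst (λ v → x ∈S C ⇔ v ∈S C) (sym (act-id x)) ⇔.refl

mapsTo-· : (g h : Elt n) {C D E : Subset n} → InG g → InG h → MapsTo g C D → MapsTo h D E → MapsTo (h · g) C E
mapsTo-· g h g-perm h-perm M M′ = from (mapsTo⇔transports (h · g) (·-perm h g h-perm g-perm))
  (transports-· g h (to (mapsTo⇔transports g g-perm) M) (to (mapsTo⇔transports h h-perm) M′))

mapsTo-inverse : (g : Elt n) (g-perm : InG g) {C D : Subset n} → MapsTo g C D → MapsTo (Inverse.inv g g-perm) D C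
mapsTo-inverse g g-perm M = from (mapsTo⇔transports (Inverse.inv g g-perm) (Inverse.inv-perm g g-perm))
  (transports-inverse g g-perm (to (mapsTo⇔transports g g-perm) M))

equivalent-refl : (C : Subset n) → Equivalent C C
equivalent-refl C = idG , id-perm , from (mapsTo⇔transports idG id-perm) (transports-id C)

equivalent-sym : {C D : Subset n} → Equivalent C D → Equivalent D C
equivalent-sym (g , g-perm , M) = Inverse.inv g g-perm , Inverse.inv-perm g g-perm , mapsTo-inverse g g-perm M

equivalent-trans : {C D E : Subset n} → Equivalent C D → Equivalent D E → Equivalent C E
equivalent-trans (g , g-perm , M) (h , h-perm , M′) = h · g , ·-perm h g h-perm g-perm , mapsTo-· g h g-perm h-perm M M′

selfDual-equivalent : {C D : Subset n} → SelfDual C → Equivalent C D → SelfDual D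
selfDual-equivalent {C = C} {D} sdC (g , g-perm , M) =
  from (SelfDual⇔SD D) (SD-transport g g-perm (to (mapsTo⇔transports g g-perm) M) (to (SelfDual⇔SD C) sdC))

fullElt : ∀ n → Full (Elt n) (2 ^ n * n ^ n)
fullElt n = fullProd (fullVec fullBool n) (fullVec (fullFin n) n)

Equivalent? : (C D : Subset n) → Dec (Equivalent C D)
Equivalent? {n} C D =
  map′ (λ (g , g-perm , T) → g , g-perm , from (mapsTo⇔transports g g-perm) T)
       (λ (g , g-perm , M) → g , g-perm , to (mapsTo⇔transports g g-perm) M)
       (∃? (fullElt n) λ g → IsPerm? (proj₂ g) ×-dec ∀? (fullWord n) (λ x → (x ∈? C) ⇔? (act g x ∈? D)))
  where
  IsPerm? : (π : Vec (Fin n) n) → Dec (IsPerm π)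
  IsPerm? π = ∀? (fullFin n) λ i → ∀? (fullFin n) λ j → (lookup π i Fin.≟ lookup π j) →-dec (i Fin.≟ j)

-- Orbit–stabiliser: |[C]| · |Aut C| = |G|

module OrbitStabiliser (C : Subset n) {a o : ℕ} (aut-count : HasCard (InAut C) a) (orbit-count : HasCard (Equivalent C) o) where

  -- the elements mapping C to a fixed D ∈ [C] form a coset g₀·Aut(C)
  coset-count : ∀ D → Equivalent C D → HasCard (λ g → InG g × MapsTo g C D) a
  coset-count D (g₀ , g₀-perm , M₀) =
    card-inverse (g₀ ·_) (g₀⁻¹ ·_)
      (λ h (h-perm , M) → ·-perm g₀ h g₀-perm h-perm , mapsTo-· h g₀ h-perm g₀-perm M M₀)
      (λ k (k-perm , M) → ·-perm g₀⁻¹ k g₀⁻¹-perm k-perm , mapsTo-· k g₀⁻¹ k-perm g₀⁻¹-perm M (mapsTo-inverse g₀ g₀-perm M₀))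
      (λ h _ → trans (sym (·-assoc g₀⁻¹ g₀ h)) (trans (cong (_· h) ·-inverseˡ) (·-identityˡ h)))
      (λ k _ → trans (sym (·-assoc g₀ g₀⁻¹ k)) (trans (cong (_· k) ·-inverseʳ) (·-identityˡ k)))
      aut-count
    where
    open Inverse g₀ g₀-perm renaming (inv to g₀⁻¹; inv-perm to g₀⁻¹-perm)

  -- G is the disjoint union of these cosets over the orbit
  orbit-times-stabiliser : o * a ≡ 2 ^ n * n !
  orbit-times-stabiliser = card-unique
    (card-image proj₂
      (λ { {D , g} {D′ , .g} (_ , _ , M) (_ , g-perm , M′) refl → cong (_, g) (transports-unique g g-perm
            (to (mapsTo⇔transports g g-perm) M) (to (mapsTo⇔transports g g-perm) M′)) })
      (λ _ (_ , g-perm , _) → g-perm)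
      (λ g g-perm → (image g g-perm C , g) ,
         (let M = from (mapsTo⇔transports g g-perm) (transports-image g g-perm C) in (g , g-perm , M) , g-perm , M) , refl)
      (card-Σ-const {P = Equivalent C} {Q = λ D g → InG g × MapsTo g C D} orbit-count coset-count))
    (group-count n)

  -- Aut C contains the identity, so a > 0 and |G| / a = o
  orbitTerm≡orbit-size : orbitTerm n a ≡ o
  orbitTerm≡orbit-size with card-nonempty {x = idG} aut-count (id-perm , from (mapsTo⇔transports idG id-perm) (transports-id C))
  ... | (a′ , refl) = trans (cong (_/ suc a′) (sym orbit-times-stabiliser)) (m*n/n≡m o (suc a′))

orbit-size : (C : Subset n) {a : ℕ} → HasCard (InAut C) a → HasCard (Equivalent C) (orbitTerm n a)
orbit-size {n} C aut-count =
  subst (HasCard _) (sym (OrbitStabiliser.orbitTerm≡orbit-size C aut-count (proj₂ orbit))) (proj₂ orbit)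
  where
  orbit : Σ ℕ (HasCard (Equivalent C))
  orbit = card-filter (fullSubset n) (Equivalent? C)

allPairs-∈ : {R : A → A → Set} {l : List A} → AllPairs R l → ∀ {x y} → x ∈ l → y ∈ l → x ≡ y ⊎ (R x y ⊎ R y x)
allPairs-∈ (r ∷ rs) (here refl) (here refl) = inj₁ refl
allPairs-∈ (r ∷ rs) (here refl) (there j) = inj₂ (inj₁ (All-lookup r j))
allPairs-∈ (r ∷ rs) (there i) (here refl) = inj₂ (inj₂ (All-lookup r i))
allPairs-∈ (r ∷ rs) (there i) (there j) = allPairs-∈ rs i j

class-sum-count : ∀ n (reps : List (Subset n × ℕ)) → IsClassSystem n reps → HasCard (SelfDual {n}) (classSum n reps)
class-sum-count n reps (reps-valid , inequivalent , covering) =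
  card-image proj₂ same-class
    (λ (r , D) (r∈ , equiv) → selfDual-equivalent (proj₁ (All-lookup reps-valid r∈)) equiv)
    (λ D sdD → let (r , r∈ , equiv) = find (covering D sdD) in (r , D) , (r∈ , equiv) , refl)
    (card-Σ-list {Q = λ (C , _) D → Equivalent C D} (λ (_ , a) → orbitTerm n a) reps reps-unique
      (λ (C , _) r∈ → orbit-size C (proj₂ (All-lookup reps-valid r∈))))
  where
  reps-unique : Unique reps
  reps-unique = AllPairs.map (λ { {C , _} {_} not-equiv refl → not-equiv (equivalent-refl C) }) inequivalent
  same-class : ∀ {(r , D) (r′ , D′) : (Subset n × ℕ) × Subset n} →
    r ∈ reps × Equivalent (proj₁ r) D → r′ ∈ reps × Equivalent (proj₁ r′) D′ → D ≡ D′ → (r , D) ≡ (r′ , D′)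
  same-class (r∈ , equiv) (r′∈ , equiv′) refl with allPairs-∈ inequivalent r∈ r′∈
  ... | inj₁ r≡r′ = cong (_, _) r≡r′
  ... | inj₂ (inj₁ not-equiv) = ⊥-elim (not-equiv (equivalent-trans equiv (equivalent-sym equiv′)))
  ... | inj₂ (inj₂ not-equiv) = ⊥-elim (not-equiv (equivalent-trans equiv′ (equivalent-sym equiv)))

-- Both M(n) and the class sum equal ∏ (2^i + 1).
theorem4p9 : (n : ℕ) → 1 ≤ n →
    HasCard (SelfDual {n}) (prodFormula n)
    × ((reps : List (Subset n × ℕ)) → IsClassSystem n reps → classSum n reps ≡ prodFormula n)
theorem4p9 n _ = selfDual-count n , λ reps classes → card-unique (class-sum-count n reps classes) (selfDual-count n)
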